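{- Every spike has property (P+): for any pair $A,B$ of bases of the spike, there exists a path with vertex set $A\triangle B$ that alternates between $A\setminus B$ and $B\setminus A$ and covers $\mathcal{C}[A\cup B]$.
   Context: A rank-$r$ spike with tip $t$ and legs $\{t,x_1,y_1\},\dots,\{t,x_r,y_r\}$ is a rank-$r$ matroid on ground set $\{t,x_1,y_1,\dots,x_r,y_r\}$ such that each leg is a circuit and, for $1\le k\le r-1$, the union of any $k$ legs has rank $k+1$. For a matroid with circuit set $\mathcal{C}$ and a subset $X$ of the ground set, $\mathcal{C}[X]$ is the set of circuits contained in $X$. A path whose vertex set is a set of matroid elements covers a family of circuits if every circuit in the family contains both endpoints of some edge of the path. -}

module Defs where

open import Data.Nat using (ℕ; suc; _≤_; _<_; _∸_)
open import Data.Fin using (Fin)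
open import Data.Fin.Subset using (Subset; ⁅_⁆; _∈_; _∉_; _⊆_; _⊂_; _∪_; _─_; ⋃; ∣_∣; ⊥; ⊤)
open import Data.Vec using (lookup)
open import Data.Bool using (if_then_else_)
open import Data.List using (List; []; _∷_; map; allFin)
import Data.List.Membership.Propositional as LM
open import Data.List.Relation.Unary.Unique.Propositional using (Unique)
open import Data.Product using (_×_; ∃-syntax; Σ-syntax)
open import Data.Sum using (_⊎_)
open import Relation.Nullary using (¬_; Dec)
open import Relation.Binary.PropositionalEquality using (_≡_; _≢_)

record Matroid (n : ℕ) : Set₁ where
  field
    Indep     : Subset n → Set
    indep?    : ∀ I → Dec (Indep I)
    indep-⊥   : Indep ⊥
    indep-⊆   : ∀ {I J} → J ⊆ I → Indep I → Indep J
    indep-aug : ∀ {I J} → Indep I → Indep J → ∣ I ∣ < ∣ J ∣ →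
                ∃[ e ] (e ∈ J × e ∉ I × Indep (I ∪ ⁅ e ⁆))

module _ {n : ℕ} (M : Matroid n) where
  open Matroid M

  Circuit : Subset n → Set
  Circuit C = ¬ Indep C × (∀ D → D ⊂ C → Indep D)

  Basis : Subset n → Set
  Basis B = Indep B × (∀ J → Indep J → B ⊆ J → J ⊆ B)

  HasRank : Subset n → ℕ → Set
  HasRank X k = (∃[ I ] (I ⊆ X × Indep I × ∣ I ∣ ≡ k))
              × (∀ J → J ⊆ X → Indep J → ∣ J ∣ ≤ k)

data Consecutive {A : Set} : A → A → List A → Set where
  here  : ∀ {u v xs} → Consecutive u v (u ∷ v ∷ xs)
  there : ∀ {w u v xs} → Consecutive u v xs → Consecutive u v (w ∷ xs)

module _ {n : ℕ} (M : Matroid n) where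

  _△_ : Subset n → Subset n → Subset n
  A △ B = (A ─ B) ∪ (B ─ A)

  -- p (a path: a list of distinct vertices, edges = consecutive pairs)
  -- has vertex set A △ B, alternates between A ─ B and B ─ A,
  -- and covers C[A ∪ B]
  GoodPath : Subset n → Subset n → List (Fin n) → Set
  GoodPath A B p =
      Unique p
    × (∀ e → e LM.∈ p → e ∈ (A △ B))
    × (∀ e → e ∈ (A △ B) → e LM.∈ p)
    × (∀ u v → Consecutive u v p →
         (u ∈ (A ─ B) × v ∈ (B ─ A)) ⊎ (u ∈ (B ─ A) × v ∈ (A ─ B)))
    × (∀ C → Circuit M C → C ⊆ (A ∪ B) →
         ∃[ u ] ∃[ v ] (Consecutive u v p × u ∈ C × v ∈ C))

  PropertyP+ : Set
  PropertyP+ = ∀ A B → Basis M A → Basis M B → ∃[ p ] GoodPath A B p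

-- rank-r spike with tip t and legs {t, x i, y i}
module _ {n : ℕ} (r : ℕ) (t : Fin n) (x y : Fin r → Fin n) where

  leg : Fin r → Subset n
  leg i = ⁅ t ⁆ ∪ (⁅ x i ⁆ ∪ ⁅ y i ⁆)

  legsUnion : Subset r → Subset n
  legsUnion S = ⋃ (map (λ i → if lookup S i then leg i else ⊥) (allFin r))

  record IsSpike (M : Matroid n) : Set where
    field
      x-inj   : ∀ i j → x i ≡ x j → i ≡ j
      y-inj   : ∀ i j → y i ≡ y j → i ≡ j
      t≢x     : ∀ i → t ≢ x i
      t≢y     : ∀ i → t ≢ y i
      x≢y     : ∀ i j → x i ≢ y j
      ground  : ∀ e → e ≡ t ⊎ (∃[ i ] (e ≡ x i ⊎ e ≡ y i))
      rank-r  : HasRank M ⊤ r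
      legs    : ∀ i → Circuit M (leg i)
      unions  : ∀ (S : Subset r) → 1 ≤ ∣ S ∣ → ∣ S ∣ ≤ r ∸ 1 →
                HasRank M (legsUnion S) (suc ∣ S ∣)

module Submission where

-- A basis of a spike of rank r ≥ 2 meets every pair {x i, y i} in exactly one element, except
-- that it either contains the tip t and misses one pair, or misses one pair and contains another
-- one whole; in rank 0 all bases are empty, and rank 1 is impossible.  A set that misses some
-- pair is independent as soon as it contains at most one whole pair, and none together with t:
-- it then lies in an r-element set spanning the remaining r - 1 legs, which have rank r.
-- For two bases A and B, the pairs on which they pick different elements become the rungs of a
-- ladder-shaped alternating path, and the few remaining elements of A △ B (on the missed and
-- whole pairs of A and B, and t) are placed on extra rungs or at the ends, so that every subset
-- of A ∪ B containing no edge of the path either lies in A or in B or is independent by the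
-- criterion above.  Hence every circuit in A ∪ B contains an edge.  In one configuration the
-- right choice of an end comes from an exchange property of the legs.

open import Data.Bool using (Bool; true; false; not; if_then_else_)
open import Data.Empty using (⊥-elim)
open import Data.Fin using (Fin; _≟_; fromℕ<; toℕ)
open import Data.Fin.Properties using (any?; toℕ-fromℕ<)
open import Data.Fin.Subset using (Subset; ⁅_⁆; _∈_; _∉_; _⊆_; _∪_; _─_; ⋃; ∣_∣; ⊥; ⊤; ∁; inside; outside)
open import Data.Fin.Subset.Properties
  using (_∈?_; x∈p∪q⁻; x∈p∪q⁺; p⊆p∪q; q⊆p∪q; x∈⁅x⁆; x∈⁅y⁆⇒x≡y; p⊂q⇒∣p∣<∣q∣; p⊆q⇒∣p∣≤∣q∣;
         p─q⊆p; x∈p∧x∉q⇒x∈p─q; ∉⊥; ∈⊤; ∣⁅x⁆∣≡1; ∣⊥∣≡0; x∈∁p⇒x∉p; ∣∁p∣≡n∸∣p∣)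
open import Data.List using (List; []; _∷_; _++_; map; filter; allFin; length; fromMaybe)
open import Data.List.Properties using (++-assoc; filter-notAll; length-tabulate)
import Data.List.Membership.Propositional as List
open import Data.List.Membership.Propositional.Properties
  using (∈-allFin; ∈-filter⁺; ∈-filter⁻; ∈-map⁺; ∈-++⁻; ∈-++⁺ˡ; ∈-++⁺ʳ)
open import Data.List.Relation.Unary.All using (All; []; _∷_)
import Data.List.Relation.Unary.All as All
import Data.List.Relation.Unary.All.Properties as All
open import Data.List.Relation.Unary.Any using (Any; here; there)
import Data.List.Relation.Unary.Any.Properties as Any
open import Data.List.Relation.Unary.AllPairs using ([]; _∷_)
open import Data.List.Relation.Unary.Unique.Propositional using (Unique)
import Data.List.Relation.Unary.Unique.Propositional.Properties as Unique
open import Data.Maybe using (Maybe; just; nothing)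
import Data.Maybe.Relation.Unary.All as Maybe
open import Data.Maybe.Relation.Unary.All using (just; nothing)
open import Data.Nat using (ℕ; zero; suc; _+_; _≤_; _<_; _∸_; z≤n; s≤s)
open import Data.Nat.Properties
  using (≤-trans; ≤-reflexive; <-≤-trans; ≤-<-trans; <-irrefl; ≰⇒>; _≤?_; +-suc; n≤1+n; +-monoʳ-≤;
         ∸-monoˡ-≤; m+[n∸m]≡n)
open import Data.Product using (_×_; _,_; ∃-syntax; proj₁; proj₂)
import Data.Product
open import Data.Sum using (_⊎_; inj₁; inj₂; [_,_]′)
import Data.Sum
open import Data.Vec using ([]; _∷_; here; there; lookup)
open import Data.Vec.Properties using (lookup⇒[]=)
open import Function using (_∘_)
open import Relation.Nullary using (¬_; Dec; yes; no; ¬?; does)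
open import Relation.Nullary.Decidable using (_×-dec_)
open import Relation.Binary.PropositionalEquality using (_≡_; _≢_; refl; sym; trans; subst; cong; ≢-sym)
open Relation.Binary.PropositionalEquality.≡-Reasoning

open import Defs

module _ {n : ℕ} where

  x∈p─q⇒x∉q : ∀ {p q : Subset n} {x} → x ∈ p ─ q → x ∉ q
  x∈p─q⇒x∉q = go
    where
    go : ∀ {m} {p q : Subset m} {x} → x ∈ p ─ q → x ∉ q
    go {p = inside ∷ _} {outside ∷ _} here ()
    go {p = _ ∷ _} {_ ∷ _} (there x∈) (there x∈q) = go x∈ x∈q

  x∈p─q⇒x∉q─p : ∀ {p q : Subset n} {x} → x ∈ p ─ q → x ∉ q ─ p
  x∈p─q⇒x∉q─p {p} {q} x∈p─q x∈q─p = x∈p─q⇒x∉q x∈p─q (p─q⊆p q p x∈q─p)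

  x∈p∪q⇒x∈q∪p : ∀ {p q : Subset n} {x} → x ∈ p ∪ q → x ∈ q ∪ p
  x∈p∪q⇒x∈q∪p {p} {q} x∈ = x∈p∪q⁺ (Data.Sum.swap (x∈p∪q⁻ p q x∈))

  p─q∪q─p⊆p∪q : ∀ {p q : Subset n} → (p ─ q) ∪ (q ─ p) ⊆ p ∪ q
  p─q∪q─p⊆p∪q {p} {q} x∈ =
    [ (λ x∈p─q → p⊆p∪q q (p─q⊆p p q x∈p─q)) , (λ x∈q─p → q⊆p∪q p q (p─q⊆p q p x∈q─p)) ]′ (x∈p∪q⁻ (p ─ q) (q ─ p) x∈)

  x∈p∪q∧x∉p⇒x∈q : ∀ {p q : Subset n} {x} → x ∈ p ∪ q → x ∉ p → x ∈ q
  x∈p∪q∧x∉p⇒x∈q {p} {q} x∈ x∉p = [ (λ x∈p → ⊥-elim (x∉p x∈p)) , (λ x∈q → x∈q) ]′ (x∈p∪q⁻ p q x∈)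

  ⊆∪∧disjoint⇒⊆ : ∀ {r p q : Subset n} → r ⊆ p ∪ q → (∀ {x} → x ∈ r → x ∉ q ─ p) → r ⊆ p
  ⊆∪∧disjoint⇒⊆ {p = p} r⊆p∪q disjoint {x} x∈r with x ∈? p
  ... | yes x∈p = x∈p
  ... | no x∉p = ⊥-elim (disjoint x∈r (x∈p∧x∉q⇒x∈p─q (x∈p∪q∧x∉p⇒x∈q (r⊆p∪q x∈r) x∉p) x∉p))

  x∈p∪⁅y⁆⁻ : ∀ {p : Subset n} {x y} → x ∈ p ∪ ⁅ y ⁆ → x ∈ p ⊎ x ≡ y
  x∈p∪⁅y⁆⁻ {p} {y = y} x∈ = Data.Sum.map₂ (x∈⁅y⁆⇒x≡y y) (x∈p∪q⁻ p ⁅ y ⁆ x∈)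

  y∈p∪⁅y⁆ : ∀ {p : Subset n} {y} → y ∈ p ∪ ⁅ y ⁆
  y∈p∪⁅y⁆ {p} {y} = q⊆p∪q p ⁅ y ⁆ (x∈⁅x⁆ y)

  p∪⁅y⁆⊆q : ∀ {p q : Subset n} {y} → p ⊆ q → y ∈ q → p ∪ ⁅ y ⁆ ⊆ q
  p∪⁅y⁆⊆q p⊆q y∈q x∈ with x∈p∪⁅y⁆⁻ x∈
  ... | inj₁ x∈p = p⊆q x∈p
  ... | inj₂ refl = y∈q

  ⁅x⁆∪⁅y⁆⊆p : ∀ {p : Subset n} {x y} → x ∈ p → y ∈ p → ⁅ x ⁆ ∪ ⁅ y ⁆ ⊆ p
  ⁅x⁆∪⁅y⁆⊆p {x = x} {y} x∈p y∈p z∈ with x∈p∪q⁻ ⁅ x ⁆ ⁅ y ⁆ z∈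
  ... | inj₁ z∈x rewrite x∈⁅y⁆⇒x≡y x z∈x = x∈p
  ... | inj₂ z∈y rewrite x∈⁅y⁆⇒x≡y y z∈y = y∈p

  ∣p∣<∣p∪⁅y⁆∣ : ∀ {p : Subset n} {y} → y ∉ p → ∣ p ∣ < ∣ p ∪ ⁅ y ⁆ ∣
  ∣p∣<∣p∪⁅y⁆∣ {p} y∉p = p⊂q⇒∣p∣<∣q∣ (p⊆p∪q _ , _ , y∈p∪⁅y⁆ , y∉p)

  ∣p∪q∣≤∣p∣+∣q∣ : ∀ (p q : Subset n) → ∣ p ∪ q ∣ ≤ ∣ p ∣ + ∣ q ∣
  ∣p∪q∣≤∣p∣+∣q∣ = go
    where
    go : ∀ {m} (p q : Subset m) → ∣ p ∪ q ∣ ≤ ∣ p ∣ + ∣ q ∣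
    go [] [] = z≤n
    go (outside ∷ p) (outside ∷ q) = go p q
    go (inside ∷ p) (outside ∷ q) = s≤s (go p q)
    go (outside ∷ p) (inside ∷ q) = ≤-trans (s≤s (go p q)) (≤-reflexive (sym (+-suc ∣ p ∣ ∣ q ∣)))
    go (inside ∷ p) (inside ∷ q) = s≤s (≤-trans (go p q) (+-monoʳ-≤ ∣ p ∣ (n≤1+n ∣ q ∣)))

  p⊆q∧∣q∣≤∣p∣⇒q⊆p : ∀ {p q : Subset n} → p ⊆ q → ∣ q ∣ ≤ ∣ p ∣ → q ⊆ p
  p⊆q∧∣q∣≤∣p∣⇒q⊆p {p} p⊆q ∣q∣≤∣p∣ {x} x∈q with x ∈? p
  ... | yes x∈p = x∈p
  ... | no x∉p = ⊥-elim (<-irrefl refl (<-≤-trans (p⊂q⇒∣p∣<∣q∣ (p⊆q , x , x∈q , x∉p)) ∣q∣≤∣p∣))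

  x∈⋃⁺ : ∀ {p : Subset n} {ps x} → p List.∈ ps → x ∈ p → x ∈ ⋃ ps
  x∈⋃⁺ {ps = _ ∷ _} (here refl) x∈p = x∈p∪q⁺ (inj₁ x∈p)
  x∈⋃⁺ {ps = _ ∷ _} (there p∈ps) x∈p = x∈p∪q⁺ (inj₂ (x∈⋃⁺ p∈ps x∈p))

  x∈⋃-map⁻ : ∀ {A : Set} {f : A → Subset n} (as : List A) {x} → x ∈ ⋃ (map f as) → ∃[ a ] (a List.∈ as × x ∈ f a)
  x∈⋃-map⁻ [] x∈ = ⊥-elim (∉⊥ x∈)
  x∈⋃-map⁻ {f = f} (a ∷ as) x∈ with x∈p∪q⁻ (f a) (⋃ (map f as)) x∈
  ... | inj₁ x∈fa = a , here refl , x∈fa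
  ... | inj₂ x∈⋃ with x∈⋃-map⁻ as x∈⋃
  ...   | b , b∈as , x∈fb = b , there b∈as , x∈fb

  ∣⋃-map-⁅⁆∣≤length : ∀ {A : Set} (f : A → Fin n) (as : List A) → ∣ ⋃ (map (λ a → ⁅ f a ⁆) as) ∣ ≤ length as
  ∣⋃-map-⁅⁆∣≤length f [] = ≤-reflexive (∣⊥∣≡0 n)
  ∣⋃-map-⁅⁆∣≤length f (a ∷ as) =
    ≤-trans (∣p∪q∣≤∣p∣+∣q∣ ⁅ f a ⁆ _)
            (subst (λ k → k + _ ≤ suc (length as)) (sym (∣⁅x⁆∣≡1 (f a))) (s≤s (∣⋃-map-⁅⁆∣≤length f as)))

module _ {A : Set} where

  ∈-insert : ∀ (us : List A) {vs ws e} → e List.∈ us ++ ws → e List.∈ us ++ vs ++ ws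
  ∈-insert us {vs} e∈ with ∈-++⁻ us e∈
  ... | inj₁ e∈us = ∈-++⁺ˡ e∈us
  ... | inj₂ e∈ws = ∈-++⁺ʳ us (∈-++⁺ʳ vs e∈ws)

  ∈-inserted : ∀ (us : List A) {vs ws e} → e List.∈ vs → e List.∈ us ++ vs ++ ws
  ∈-inserted us e∈vs = ∈-++⁺ʳ us (∈-++⁺ˡ e∈vs)

  Unique-insert : ∀ (us : List A) {vs ws} → Unique (us ++ ws) → Unique vs →
    (∀ {e} → e List.∈ us ++ ws → e List.∉ vs) → Unique (us ++ vs ++ ws)
  Unique-insert [] unique-ws unique-vs disjoint = Unique.++⁺ unique-vs unique-ws (λ (e∈vs , e∈ws) → disjoint e∈ws e∈vs)
  Unique-insert (u ∷ us) {vs} (u∉ ∷ unique) unique-vs disjoint =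
    All.++⁺ (proj₁ (All.++⁻ us u∉)) (All.++⁺ (All.¬Any⇒All¬ vs (disjoint (here refl))) (proj₂ (All.++⁻ us u∉))) ∷
    Unique-insert us unique unique-vs (disjoint ∘ there)

module Spanning {n : ℕ} (M : Matroid n) where
  open Matroid M

  _Spans_ : Subset n → Subset n → Set
  L Spans W = ∀ f → f ∈ W → f ∉ L → ¬ Indep (L ∪ ⁅ f ⁆)

  Spans-⊆ : ∀ {L W V} → L Spans W → V ⊆ W → L Spans V
  Spans-⊆ L-spans V⊆W f f∈V = L-spans f (V⊆W f∈V)

  ∣indep∣≤∣spanning∣ : ∀ {L W K} → Indep L → L Spans W → K ⊆ W → Indep K → ∣ K ∣ ≤ ∣ L ∣
  ∣indep∣≤∣spanning∣ {L} {W} {K} indL L-spans K⊆W indK with ∣ K ∣ ≤? ∣ L ∣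
  ... | yes ≤ = ≤
  ... | no ≰ with indep-aug indL indK (≰⇒> ≰)
  ...   | e , e∈K , e∉L , indL+e = ⊥-elim (L-spans e (K⊆W e∈K) e∉L indL+e)

  private
    extend-along : ∀ {W L₀} (es : List (Fin n)) (L : Subset n) → L₀ ⊆ L → L ⊆ W → Indep L →
      ∃[ L′ ] (L ⊆ L′ × L′ ⊆ W × Indep L′ × (∀ f → f List.∈ es → f ∈ W → f ∉ L′ → ¬ Indep (L′ ∪ ⁅ f ⁆)))
    extend-along [] L _ L⊆W indL = L , (λ x∈ → x∈) , L⊆W , indL , λ _ ()
    extend-along {W} (e ∷ es) L L₀⊆L L⊆W indL with e ∈? W
    ... | no e∉W with extend-along es L L₀⊆L L⊆W indL
    ...   | L′ , L⊆L′ , L′⊆W , indL′ , max =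
            L′ , L⊆L′ , L′⊆W , indL′ , λ { f (here refl) f∈W → ⊥-elim (e∉W f∈W) ; f (there f∈es) → max f f∈es }
    extend-along {W} (e ∷ es) L L₀⊆L L⊆W indL | yes e∈W with indep? (L ∪ ⁅ e ⁆)
    ... | yes indL+e with extend-along es (L ∪ ⁅ e ⁆) (λ x∈ → p⊆p∪q _ (L₀⊆L x∈)) (p∪⁅y⁆⊆q L⊆W e∈W) indL+e
    ...   | L′ , L+e⊆L′ , L′⊆W , indL′ , max =
            L′ , (λ x∈ → L+e⊆L′ (p⊆p∪q _ x∈)) , L′⊆W , indL′ ,
            λ { f (here refl) _ e∉L′ → ⊥-elim (e∉L′ (L+e⊆L′ y∈p∪⁅y⁆)) ; f (there f∈es) → max f f∈es }
    extend-along {W} (e ∷ es) L L₀⊆L L⊆W indL | yes e∈W | no ¬indL+e with extend-along es L L₀⊆L L⊆W indL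
    ... | L′ , L⊆L′ , L′⊆W , indL′ , max =
          L′ , L⊆L′ , L′⊆W , indL′ ,
          λ { f (here refl) _ _ indL′+e → ¬indL+e (indep-⊆ (p∪⁅y⁆⊆q (p⊆p∪q _ ∘ L⊆L′) y∈p∪⁅y⁆) indL′+e)
            ; f (there f∈es) → max f f∈es }

  extend-to-spanning : ∀ {L₀ W} → L₀ ⊆ W → Indep L₀ → ∃[ L ] (L₀ ⊆ L × L ⊆ W × Indep L × L Spans W)
  extend-to-spanning L₀⊆W indL₀ with extend-along (allFin n) _ (λ x∈ → x∈) L₀⊆W indL₀
  ... | L , L₀⊆L , L⊆W , indL , max = L , L₀⊆L , L⊆W , indL , λ f → max f (∈-allFin f)

  spanning-subset : ∀ W → ∃[ L ] (L ⊆ W × Indep L × L Spans W)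
  spanning-subset W with extend-to-spanning {W = W} (λ x∈⊥ → ⊥-elim (∉⊥ x∈⊥)) indep-⊥
  ... | L , _ , spanning = L , spanning

  -- Extend {a, b} to L′ spanning W + c; as L′ avoids c, |L′| ≤ |L| < |L + c|, and augmenting L′
  -- from an independent L + c would contradict that L′ spans W + c.
  Spans-∪-triangle : ∀ {L W a b c} → L ⊆ W → Indep L → L Spans W → a ∈ W → b ∈ W →
    Indep (⁅ a ⁆ ∪ ⁅ b ⁆) → (∀ J → a ∈ J → b ∈ J → c ∈ J → ¬ Indep J) → L Spans (W ∪ ⁅ c ⁆)
  Spans-∪-triangle {L} {W} {a} {b} {c} L⊆W indL L-spans a∈W b∈W ind-ab dep-abc f f∈W+c f∉L
    with x∈p∪⁅y⁆⁻ f∈W+c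
  ... | inj₁ f∈W = L-spans f f∈W f∉L
  ... | inj₂ refl = dependent (extend-to-spanning (⁅x⁆∪⁅y⁆⊆p (p⊆p∪q _ a∈W) (p⊆p∪q _ b∈W)) ind-ab)
    where
    dependent : ∃[ L′ ] (⁅ a ⁆ ∪ ⁅ b ⁆ ⊆ L′ × L′ ⊆ W ∪ ⁅ c ⁆ × Indep L′ × L′ Spans (W ∪ ⁅ c ⁆)) →
                ¬ Indep (L ∪ ⁅ c ⁆)
    dependent (L′ , ab⊆L′ , L′⊆W+c , indL′ , L′-spans) indL+c with indep-aug indL′ indL+c ∣L′∣<∣L+c∣
      where
      c∉L′ : c ∉ L′
      c∉L′ c∈L′ =
        dep-abc L′ (ab⊆L′ (x∈p∪q⁺ (inj₁ (x∈⁅x⁆ a)))) (ab⊆L′ (x∈p∪q⁺ (inj₂ (x∈⁅x⁆ b)))) c∈L′ indL′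
      L′⊆W : L′ ⊆ W
      L′⊆W x∈ with x∈p∪⁅y⁆⁻ (L′⊆W+c x∈)
      ... | inj₁ x∈W = x∈W
      ... | inj₂ refl = ⊥-elim (c∉L′ x∈)
      ∣L′∣<∣L+c∣ : ∣ L′ ∣ < ∣ L ∪ ⁅ c ⁆ ∣
      ∣L′∣<∣L+c∣ = ≤-<-trans (∣indep∣≤∣spanning∣ indL L-spans L′⊆W indL′) (∣p∣<∣p∪⁅y⁆∣ f∉L)
    ... | e , e∈L+c , e∉L′ , indL′+e = L′-spans e e∈W+c e∉L′ indL′+e
      where
      e∈W+c : e ∈ W ∪ ⁅ c ⁆
      e∈W+c with x∈p∪⁅y⁆⁻ e∈L+c
      ... | inj₁ e∈L = p⊆p∪q _ (L⊆W e∈L)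
      ... | inj₂ refl = y∈p∪⁅y⁆

module _ {n : ℕ} (M : Matroid n) where
  open Matroid M

  goodPath-sym : ∀ {A B p} → GoodPath M A B p → GoodPath M B A p
  goodPath-sym (unique , ⊆Δ , Δ⊆ , alternates , covers) =
    unique , (λ e e∈p → x∈p∪q⇒x∈q∪p (⊆Δ e e∈p)) , (λ e e∈Δ → Δ⊆ e (x∈p∪q⇒x∈q∪p e∈Δ)) ,
    (λ u v uv → Data.Sum.swap (alternates u v uv)) , (λ C circuit C⊆B∪A → covers C circuit (x∈p∪q⇒x∈q∪p ∘ C⊆B∪A))

  rank-zero-propertyP+ : HasRank M ⊤ 0 → PropertyP+ M
  rank-zero-propertyP+ (_ , ∣indep∣≤0) A B (indA , _) (indB , _) =
    [] , [] , (λ _ ()) , (λ e e∈Δ → ⊥-elim (A∪B-empty (p─q∪q─p⊆p∪q e∈Δ))) , (λ _ _ ()) ,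
    λ C (dependent , _) C⊆A∪B → ⊥-elim (dependent (indep-⊆ (λ e∈C → ⊥-elim (A∪B-empty (C⊆A∪B e∈C))) indep-⊥))
    where
    indep-empty : ∀ {J e} → Indep J → e ∉ J
    indep-empty {J} {e} indJ e∈J with ≤-trans (≤-reflexive (sym (∣⁅x⁆∣≡1 e)))
      (≤-trans (p⊆q⇒∣p∣≤∣q∣ (λ x∈ → subst (_∈ J) (sym (x∈⁅y⁆⇒x≡y e x∈)) e∈J))
               (∣indep∣≤0 J (λ _ → ∈⊤) indJ))
    ... | ()
    A∪B-empty : ∀ {e} → e ∉ A ∪ B
    A∪B-empty e∈ = [ indep-empty indA , indep-empty indB ]′ (x∈p∪q⁻ A B e∈)

module _ {n : ℕ} where

  rungs : List (Fin n × Fin n) → List (Fin n)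
  rungs [] = []
  rungs ((b , a) ∷ bas) = b ∷ a ∷ rungs bas

  -- The path a₀ b₁ a₁ … b_k a_k b_{k+1}, where the ends a₀ and b_{k+1} are optional.
  ladder : Maybe (Fin n) → List (Fin n × Fin n) → Maybe (Fin n) → List (Fin n)
  ladder ma bas mb = fromMaybe ma ++ rungs bas ++ fromMaybe mb

  Stable : List (Fin n) → Subset n → Set
  Stable p X = ∀ {u v} → Consecutive u v p → u ∈ X → v ∉ X

  Meets Misses : Subset n → Fin n × Fin n → Set
  Meets X (b , a) = b ∈ X ⊎ a ∈ X
  Misses X (b , a) = b ∉ X × a ∉ X

  Meets-a∉ : ∀ {X b a} → Meets X (b , a) → a ∉ X → b ∈ X
  Meets-a∉ meets a∉X = [ (λ b∈X → b∈X) , (λ a∈X → ⊥-elim (a∉X a∈X)) ]′ meets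

  Meets-b∉ : ∀ {X b a} → Meets X (b , a) → b ∉ X → a ∈ X
  Meets-b∉ meets b∉X = [ (λ b∈X → ⊥-elim (b∉X b∈X)) , (λ a∈X → a∈X) ]′ meets

  Consecutive-++ : ∀ (us : List (Fin n)) {vs u v} → Consecutive u v vs → Consecutive u v (us ++ vs)
  Consecutive-++ [] uv = uv
  Consecutive-++ (_ ∷ us) uv = there (Consecutive-++ us uv)

  Stable-++ : ∀ (us : List (Fin n)) {vs X} → Stable (us ++ vs) X → Stable vs X
  Stable-++ us stable uv = stable (Consecutive-++ us uv)

  rung-consecutive : ∀ {ma bas mb b a} → (b , a) List.∈ bas → Consecutive b a (ladder ma bas mb)
  rung-consecutive {ma} {bas} {mb} ba∈ = Consecutive-++ (fromMaybe ma) (go bas ba∈)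
    where
    go : ∀ bas {b a} → (b , a) List.∈ bas → Consecutive b a (rungs bas ++ fromMaybe mb)
    go (_ ∷ _) (here refl) = here
    go (_ ∷ bas) (there ba∈) = there (there (go bas ba∈))

  ∈-rungs : ∀ {bas b a} → (b , a) List.∈ bas → b List.∈ rungs bas × a List.∈ rungs bas
  ∈-rungs {_ ∷ _} (here refl) = here refl , there (here refl)
  ∈-rungs {_ ∷ _} (there ba∈) = there (there (proj₁ (∈-rungs ba∈))) , there (there (proj₂ (∈-rungs ba∈)))

  All-ladder : ∀ {P : Fin n → Set} {ma bas mb} → Maybe.All P ma → All (λ ba → P (proj₁ ba) × P (proj₂ ba)) bas →
    Maybe.All P mb → All P (ladder ma bas mb)
  All-ladder {P} Pma Pbas Pmb = All.++⁺ (end Pma) (All.++⁺ (middle Pbas) (end Pmb))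
    where
    end : ∀ {m} → Maybe.All P m → All P (fromMaybe m)
    end nothing = []
    end (just Pe) = Pe ∷ []
    middle : ∀ {bas} → All (λ ba → P (proj₁ ba) × P (proj₂ ba)) bas → All P (rungs bas)
    middle [] = []
    middle ((Pb , Pa) ∷ Pbas) = Pb ∷ Pa ∷ middle Pbas

  ladder-++ : ∀ ma K R mb → ladder ma (K ++ R) mb ≡ (fromMaybe ma ++ rungs K) ++ rungs R ++ fromMaybe mb
  ladder-++ ma K R mb = begin
    fromMaybe ma ++ rungs (K ++ R) ++ fromMaybe mb          ≡⟨ cong (λ vs → fromMaybe ma ++ vs ++ fromMaybe mb) (rungs-++ K) ⟩
    fromMaybe ma ++ (rungs K ++ rungs R) ++ fromMaybe mb    ≡⟨ cong (fromMaybe ma ++_) (++-assoc (rungs K) (rungs R) (fromMaybe mb)) ⟩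
    fromMaybe ma ++ rungs K ++ rungs R ++ fromMaybe mb      ≡⟨ ++-assoc (fromMaybe ma) (rungs K) _ ⟨
    (fromMaybe ma ++ rungs K) ++ rungs R ++ fromMaybe mb    ∎
    where
    rungs-++ : ∀ K → rungs (K ++ R) ≡ rungs K ++ rungs R
    rungs-++ [] = refl
    rungs-++ ((b , a) ∷ K) = cong (λ vs → b ∷ a ∷ vs) (rungs-++ K)

  ladder-assoc : ∀ ma K mb → ladder ma K mb ≡ (fromMaybe ma ++ rungs K) ++ fromMaybe mb
  ladder-assoc ma K mb = sym (++-assoc (fromMaybe ma) (rungs K) (fromMaybe mb))

  ∈-ladder-++ˡ : ∀ ma K mb R {e} → e List.∈ ladder ma K mb → e List.∈ ladder ma (K ++ R) mb
  ∈-ladder-++ˡ ma K mb R {e} e∈ =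
    subst (e List.∈_) (sym (ladder-++ ma K R mb)) (∈-insert (fromMaybe ma ++ rungs K) (subst (e List.∈_) (ladder-assoc ma K mb) e∈))

  ∈-ladder-++ʳ : ∀ ma K mb R {e} → e List.∈ rungs R → e List.∈ ladder ma (K ++ R) mb
  ∈-ladder-++ʳ ma K mb R {e} e∈ = subst (e List.∈_) (sym (ladder-++ ma K R mb)) (∈-inserted (fromMaybe ma ++ rungs K) e∈)

  Unique-ladder-++ : ∀ ma K mb R → Unique (ladder ma K mb) → Unique (rungs R) →
    (∀ {e} → e List.∈ ladder ma K mb → e List.∉ rungs R) → Unique (ladder ma (K ++ R) mb)
  Unique-ladder-++ ma K mb R unique unique-R disjoint =
    subst Unique (sym (ladder-++ ma K R mb))
      (Unique-insert (fromMaybe ma ++ rungs K) (subst Unique (ladder-assoc ma K mb) unique) unique-R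
        (λ {e} e∈ → disjoint (subst (e List.∈_) (sym (ladder-assoc ma K mb)) e∈)))

  edge⊎stable : ∀ (p : List (Fin n)) X → (∃[ u ] ∃[ v ] (Consecutive u v p × u ∈ X × v ∈ X)) ⊎ Stable p X
  edge⊎stable [] X = inj₂ λ ()
  edge⊎stable (u ∷ []) X = inj₂ λ { (there ()) }
  edge⊎stable (u ∷ v ∷ p) X with u ∈? X | v ∈? X | edge⊎stable (v ∷ p) X
  ... | yes u∈X | yes v∈X | _ = inj₁ (u , v , here , u∈X , v∈X)
  ... | _ | _ | inj₁ (u′ , v′ , uv , u′∈X , v′∈X) = inj₁ (u′ , v′ , there uv , u′∈X , v′∈X)
  ... | yes u∈X | no v∉X | inj₂ stable = inj₂ λ { here _ → v∉X ; (there uv) → stable uv }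
  ... | no u∉X | _ | inj₂ stable = inj₂ λ { here u∈X → ⊥-elim (u∉X u∈X) ; (there uv) → stable uv }

  all-meet⊎any-missed : ∀ X (bas : List (Fin n × Fin n)) → All (Meets X) bas ⊎ Any (Misses X) bas
  all-meet⊎any-missed X [] = inj₁ []
  all-meet⊎any-missed X ((b , a) ∷ bas) with b ∈? X | a ∈? X | all-meet⊎any-missed X bas
  ... | no b∉X | no a∉X | _ = inj₂ (here (b∉X , a∉X))
  ... | _ | _ | inj₂ missed = inj₂ (there missed)
  ... | yes b∈X | _ | inj₁ meet = inj₁ (inj₁ b∈X ∷ meet)
  ... | no _ | yes a∈X | inj₁ meet = inj₁ (inj₂ a∈X ∷ meet)

  end∈⊎∉ : ∀ X (m : Maybe (Fin n)) → ∃[ e ] (m ≡ just e × e ∈ X) ⊎ Maybe.All (_∉ X) m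
  end∈⊎∉ X nothing = inj₂ nothing
  end∈⊎∉ X (just e) with e ∈? X
  ... | yes e∈X = inj₁ (e , refl , e∈X)
  ... | no e∉X = inj₂ (just e∉X)

  stable-forward : ∀ {X} bas {a mb} → Stable (ladder (just a) bas mb) X → All (Meets X) bas → a ∈ X →
    All (λ ba → proj₁ ba ∉ X) bas × Maybe.All (_∉ X) mb
  stable-forward [] {mb = nothing} _ _ _ = [] , nothing
  stable-forward [] {mb = just b} stable _ a∈X = [] , just (stable here a∈X)
  stable-forward ((b , a′) ∷ bas) stable (meet ∷ meets) a∈X with stable here a∈X
  ... | b∉X with stable-forward bas (λ uv → stable (there (there uv))) meets (Meets-b∉ meet b∉X)
  ...   | bs∉X , mb∉X = b∉X ∷ bs∉X , mb∉X

  stable-backward : ∀ {X} ma bas {b} → Stable (ladder ma bas (just b)) X → All (Meets X) bas → b ∈ X →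
    Maybe.All (_∉ X) ma × All (λ ba → proj₁ ba ∈ X × proj₂ ba ∉ X) bas
  stable-backward {X} ma bas {b} stable meets b∈X = start ma bas stable rungs-alternate , rungs-alternate
    where
    go : ∀ bas → Stable (rungs bas ++ b ∷ []) X → All (Meets X) bas → All (λ ba → proj₁ ba ∈ X × proj₂ ba ∉ X) bas
    go [] _ _ = []
    go ((b′ , a′) ∷ []) stable (meet ∷ []) = (Meets-a∉ meet a′∉X , a′∉X) ∷ []
      where
      a′∉X : a′ ∉ X
      a′∉X a′∈X = stable (there here) a′∈X b∈X
    go ((b′ , a′) ∷ (b″ , a″) ∷ bas) stable (meet ∷ meets) with go ((b″ , a″) ∷ bas) (λ uv → stable (there (there uv))) meets
    ... | (b″∈X , a″∉X) ∷ rest = (Meets-a∉ meet a′∉X , a′∉X) ∷ (b″∈X , a″∉X) ∷ rest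
      where
      a′∉X : a′ ∉ X
      a′∉X a′∈X = stable (there here) a′∈X b″∈X
    rungs-alternate : All (λ ba → proj₁ ba ∈ X × proj₂ ba ∉ X) bas
    rungs-alternate = go bas (Stable-++ (fromMaybe ma) stable) meets
    start : ∀ ma bas → Stable (ladder ma bas (just b)) X → All (λ ba → proj₁ ba ∈ X × proj₂ ba ∉ X) bas → Maybe.All (_∉ X) ma
    start nothing _ _ _ = nothing
    start (just a) [] stable _ = just λ a∈X → stable here a∈X b∈X
    start (just a) (_ ∷ _) stable ((b₁∈X , _) ∷ _) = just λ a∈X → stable here a∈X b₁∈X

module Ladder {n : ℕ} (M : Matroid n) (A B : Subset n) where
  open Matroid M

  Rung : Fin n × Fin n → Set
  Rung (b , a) = b ∈ B ─ A × a ∈ A ─ B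

  Side : Bool → Subset n
  Side true = A ─ B
  Side false = B ─ A

  data Alternating : Bool → List (Fin n) → Set where
    [] : ∀ {s} → Alternating s []
    _∷_ : ∀ {s u us} → u ∈ Side s → Alternating (not s) us → Alternating s (u ∷ us)

  Alternating-edge : ∀ {s us u v} → Alternating s us → Consecutive u v us →
    (u ∈ A ─ B × v ∈ B ─ A) ⊎ (u ∈ B ─ A × v ∈ A ─ B)
  Alternating-edge {true} (u∈ ∷ (v∈ ∷ _)) here = inj₁ (u∈ , v∈)
  Alternating-edge {false} (u∈ ∷ (v∈ ∷ _)) here = inj₂ (u∈ , v∈)
  Alternating-edge (_ ∷ alt) (there uv) = Alternating-edge alt uv

  ladder-alternating : ∀ {ma bas mb} → Maybe.All (_∈ A ─ B) ma → All Rung bas → Maybe.All (_∈ B ─ A) mb →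
    ∃[ s ] Alternating s (ladder ma bas mb)
  ladder-alternating {mb = mb} start middle end with rest middle end
    where
    rest : ∀ {bas} → All Rung bas → Maybe.All (_∈ B ─ A) mb → Alternating false (rungs bas ++ fromMaybe mb)
    rest [] nothing = []
    rest [] (just b∈) = b∈ ∷ []
    rest ((b∈ , a∈) ∷ middle) end = b∈ ∷ (a∈ ∷ rest middle end)
  ... | alt with start
  ...   | nothing = false , alt
  ...   | just a∈ = true , a∈ ∷ alt

  -- Unless a stable set misses a rung or both ends, walking from an end in it confines it to A or to B.
  ladder-goodPath : ∀ {ma bas mb} → Indep A → Indep B →
    Maybe.All (_∈ A ─ B) ma → All Rung bas → Maybe.All (_∈ B ─ A) mb →
    Unique (ladder ma bas mb) →
    (∀ e → e ∈ (A ─ B) ∪ (B ─ A) → e List.∈ ladder ma bas mb) →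
    (∀ X → X ⊆ A ∪ B → Stable (ladder ma bas mb) X →
       Any (Misses X) bas ⊎ (Maybe.All (_∉ X) ma × Maybe.All (_∉ X) mb) → Indep X) →
    GoodPath M A B (ladder ma bas mb)
  ladder-goodPath {ma} {bas} {mb} indA indB start middle end unique covers stable-indep =
    unique , (λ e e∈p → All.lookup in-Δ e∈p) , covers ,
    (λ u v uv → Alternating-edge (proj₂ (ladder-alternating start middle end)) uv) , circuit-edge
    where
    in-Δ : All (_∈ (A ─ B) ∪ (B ─ A)) (ladder ma bas mb)
    in-Δ = All-ladder (Maybe.map (x∈p∪q⁺ ∘ inj₁) start)
                      (All.map (λ (b∈ , a∈) → x∈p∪q⁺ (inj₂ b∈) , x∈p∪q⁺ (inj₁ a∈)) middle)
                      (Maybe.map (x∈p∪q⁺ ∘ inj₂) end)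

    stable⇒indep : ∀ X → X ⊆ A ∪ B → Stable (ladder ma bas mb) X → Indep X
    stable⇒indep X X⊆A∪B stable with all-meet⊎any-missed X bas | end∈⊎∉ X ma | end∈⊎∉ X mb
    ... | inj₂ missed | _ | _ = stable-indep X X⊆A∪B stable (inj₁ missed)
    ... | inj₁ meets | inj₂ ma∉X | inj₂ mb∉X = stable-indep X X⊆A∪B stable (inj₂ (ma∉X , mb∉X))
    ... | inj₁ meets | inj₁ (a , refl , a∈X) | _ with stable-forward bas stable meets a∈X
    ...   | bs∉X , mb∉X =
      indep-⊆ (⊆∪∧disjoint⇒⊆ X⊆A∪B λ e∈X e∈B─A → All.lookup no-B (covers _ (x∈p∪q⁺ (inj₂ e∈B─A))) e∈X e∈B─A) indA
      where
      no-B : All (λ e → e ∈ X → e ∉ B ─ A) (ladder ma bas mb)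
      no-B = All-ladder (Maybe.map (λ a∈ _ → x∈p─q⇒x∉q─p a∈) start)
                        (All.zipWith (λ ((_ , a∈) , b∉X) → (λ b∈X → ⊥-elim (b∉X b∈X)) , (λ _ → x∈p─q⇒x∉q─p a∈))
                                     (middle , bs∉X))
                        (Maybe.map (λ b∉X b∈X → ⊥-elim (b∉X b∈X)) mb∉X)
    stable⇒indep X X⊆A∪B stable | inj₁ meets | _ | inj₁ (b , refl , b∈X) with stable-backward ma bas stable meets b∈X
    ... | ma∉X , rungs-alternate =
      indep-⊆ (⊆∪∧disjoint⇒⊆ (x∈p∪q⇒x∈q∪p ∘ X⊆A∪B) λ e∈X e∈A─B → All.lookup no-A (covers _ (x∈p∪q⁺ (inj₁ e∈A─B))) e∈X e∈A─B)
              indB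
      where
      no-A : All (λ e → e ∈ X → e ∉ A ─ B) (ladder ma bas (just b))
      no-A = All-ladder (Maybe.map (λ a∉X a∈X → ⊥-elim (a∉X a∈X)) ma∉X)
                        (All.zipWith (λ ((b∈ , _) , (_ , a∉X)) → (λ _ → x∈p─q⇒x∉q─p b∈) , (λ a∈X → ⊥-elim (a∉X a∈X)))
                                     (middle , rungs-alternate))
                        (just (λ _ → x∈p─q⇒x∉q─p (Maybe.drop-just end)))

    circuit-edge : ∀ C → Circuit M C → C ⊆ A ∪ B → ∃[ u ] ∃[ v ] (Consecutive u v (ladder ma bas mb) × u ∈ C × v ∈ C)
    circuit-edge C (dependent , _) C⊆A∪B with edge⊎stable (ladder ma bas mb) C
    ... | inj₁ edge = edge
    ... | inj₂ stable = ⊥-elim (dependent (stable⇒indep C C⊆A∪B stable))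

module Spike {n r : ℕ} {t : Fin n} {x y : Fin r → Fin n} {M : Matroid n} (S : IsSpike r t x y M) where
  open Matroid M
  open IsSpike S
  open Spanning M

  At : Fin n → Fin r → Set
  At e i = e ≡ x i ⊎ e ≡ y i

  Hole Full Single : Subset n → Fin r → Set
  Hole X i = x i ∉ X × y i ∉ X
  Full X i = x i ∈ X × y i ∈ X
  Single X i = (x i ∈ X × y i ∉ X) ⊎ (x i ∉ X × y i ∈ X)

  Hole? : ∀ X i → Dec (Hole X i)
  Hole? X i = ¬? (x i ∈? X) ×-dec ¬? (y i ∈? X)

  Full? : ∀ X i → Dec (Full X i)
  Full? X i = (x i ∈? X) ×-dec (y i ∈? X)

  Single-if-¬Hole-¬Full : ∀ {X i} → ¬ Hole X i → ¬ Full X i → Single X i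
  Single-if-¬Hole-¬Full {X} {i} ¬hole ¬full with x i ∈? X | y i ∈? X
  ... | yes x∈ | yes y∈ = ⊥-elim (¬full (x∈ , y∈))
  ... | yes x∈ | no y∉ = inj₁ (x∈ , y∉)
  ... | no x∉ | yes y∈ = inj₂ (x∉ , y∈)
  ... | no x∉ | no y∉ = ⊥-elim (¬hole (x∉ , y∉))

  At-unique : ∀ {e i j} → At e i → At e j → i ≡ j
  At-unique {i = i} {j} (inj₁ refl) (inj₁ x≡) = x-inj i j x≡
  At-unique {i = i} {j} (inj₁ refl) (inj₂ x≡y) = ⊥-elim (x≢y i j x≡y)
  At-unique {i = i} {j} (inj₂ refl) (inj₁ y≡x) = ⊥-elim (x≢y j i (sym y≡x))
  At-unique {i = i} {j} (inj₂ refl) (inj₂ y≡) = y-inj i j y≡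

  At-≢ : ∀ {e f i j} → At e i → At f j → i ≢ j → e ≢ f
  At-≢ e-at f-at i≢j refl = i≢j (At-unique e-at f-at)

  t≢At : ∀ {e i} → At e i → t ≢ e
  t≢At {i = i} (inj₁ refl) = t≢x i
  t≢At {i = i} (inj₂ refl) = t≢y i

  Hole-At : ∀ {X i e} → Hole X i → At e i → e ∉ X
  Hole-At (x∉ , _) (inj₁ refl) = x∉
  Hole-At (_ , y∉) (inj₂ refl) = y∉

  Full-At : ∀ {X i e} → Full X i → At e i → e ∈ X
  Full-At (x∈ , _) (inj₁ refl) = x∈
  Full-At (_ , y∈) (inj₂ refl) = y∈

  Hole-¬Single : ∀ {X i} → Hole X i → ¬ Single X i
  Hole-¬Single (x∉ , _) (inj₁ (x∈ , _)) = x∉ x∈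
  Hole-¬Single (_ , y∉) (inj₂ (_ , y∈)) = y∉ y∈

  Full-¬Single : ∀ {X i} → Full X i → ¬ Single X i
  Full-¬Single (_ , y∈) (inj₁ (_ , y∉)) = y∉ y∈
  Full-¬Single (x∈ , _) (inj₂ (x∉ , _)) = x∉ x∈

  Full-¬Hole : ∀ {X i} → Full X i → ¬ Hole X i
  Full-¬Hole (x∈ , _) (x∉ , _) = x∉ x∈

  Hole-∪-tip : ∀ {X i} → Hole X i → Hole (X ∪ ⁅ t ⁆) i
  Hole-∪-tip {i = i} (x∉ , y∉) =
    [ x∉ , (λ x≡t → t≢x i (sym x≡t)) ]′ ∘ x∈p∪⁅y⁆⁻ , [ y∉ , (λ y≡t → t≢y i (sym y≡t)) ]′ ∘ x∈p∪⁅y⁆⁻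

  Full-∪-tip : ∀ {X i} → Full (X ∪ ⁅ t ⁆) i → Full X i
  Full-∪-tip {i = i} (x∈ , y∈) =
    [ (λ x∈X → x∈X) , (λ x≡t → ⊥-elim (t≢x i (sym x≡t))) ]′ (x∈p∪⁅y⁆⁻ x∈) ,
    [ (λ y∈X → y∈X) , (λ y≡t → ⊥-elim (t≢y i (sym y≡t))) ]′ (x∈p∪⁅y⁆⁻ y∈)

  ¬Full-tipped : ∀ {X h i} → Hole X h → (∀ j → j ≢ h → Single X j) → ¬ Full X i
  ¬Full-tipped {h = h} {i} hole singles full with i ≟ h
  ... | yes refl = Full-¬Hole full hole
  ... | no i≢h = Full-¬Single full (singles i i≢h)

  Full-doubled : ∀ {X p h i} → Hole X h → (∀ j → j ≢ h → j ≢ p → Single X j) → Full X i → i ≡ p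
  Full-doubled {p = p} {h} {i} hole singles full with i ≟ h | i ≟ p
  ... | yes refl | _ = ⊥-elim (Full-¬Hole full hole)
  ... | no _ | yes i≡p = i≡p
  ... | no i≢h | no i≢p = ⊥-elim (Full-¬Single full (singles i i≢h i≢p))

  ∈-leg⁻ : ∀ {i e} → e ∈ leg r t x y i → e ≡ t ⊎ At e i
  ∈-leg⁻ {i} e∈ with x∈p∪q⁻ ⁅ t ⁆ (⁅ x i ⁆ ∪ ⁅ y i ⁆) e∈
  ... | inj₁ e∈t = inj₁ (x∈⁅y⁆⇒x≡y t e∈t)
  ... | inj₂ e∈xy = inj₂ (Data.Sum.map (x∈⁅y⁆⇒x≡y _) (x∈⁅y⁆⇒x≡y _) (x∈p∪q⁻ ⁅ x i ⁆ ⁅ y i ⁆ e∈xy))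

  t∈leg : ∀ i → t ∈ leg r t x y i
  t∈leg i = x∈p∪q⁺ (inj₁ (x∈⁅x⁆ t))

  At∈leg : ∀ {e i} → At e i → e ∈ leg r t x y i
  At∈leg {i = i} (inj₁ refl) = x∈p∪q⁺ (inj₂ (x∈p∪q⁺ (inj₁ (x∈⁅x⁆ (x i)))))
  At∈leg {i = i} (inj₂ refl) = x∈p∪q⁺ (inj₂ (x∈p∪q⁺ (inj₂ (x∈⁅x⁆ (y i)))))

  At-other : ∀ {a b e i} → At a i → At b i → a ≢ b → At e i → e ≡ a ⊎ e ≡ b
  At-other (inj₁ refl) _ _ (inj₁ refl) = inj₁ refl
  At-other (inj₂ refl) _ _ (inj₂ refl) = inj₁ refl
  At-other (inj₁ refl) (inj₂ refl) _ (inj₂ refl) = inj₂ refl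
  At-other (inj₂ refl) (inj₁ refl) _ (inj₁ refl) = inj₂ refl
  At-other (inj₁ refl) (inj₁ refl) a≢b (inj₂ refl) = ⊥-elim (a≢b refl)
  At-other (inj₂ refl) (inj₂ refl) a≢b (inj₁ refl) = ⊥-elim (a≢b refl)

  leg-dependent : ∀ {i a b J} → At a i → At b i → a ≢ b → t ∈ J → a ∈ J → b ∈ J → ¬ Indep J
  leg-dependent {i} {a} {b} {J} a-at b-at a≢b t∈J a∈J b∈J indJ = proj₁ (legs i) (indep-⊆ leg⊆J indJ)
    where
    leg⊆J : leg r t x y i ⊆ J
    leg⊆J e∈ with ∈-leg⁻ e∈
    ... | inj₁ refl = t∈J
    ... | inj₂ e-at with At-other a-at b-at a≢b e-at
    ...   | inj₁ refl = a∈J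
    ...   | inj₂ refl = b∈J

  pair-in-leg-indep : ∀ {i a b c} → a ∈ leg r t x y i → b ∈ leg r t x y i → c ∈ leg r t x y i →
    c ≢ a → c ≢ b → Indep (⁅ a ⁆ ∪ ⁅ b ⁆)
  pair-in-leg-indep {i} {a} {b} {c} a∈ b∈ c∈ c≢a c≢b = proj₂ (legs i) _ (ab⊆leg , c , c∈ , c∉ab)
    where
    ab⊆leg : ⁅ a ⁆ ∪ ⁅ b ⁆ ⊆ leg r t x y i
    ab⊆leg e∈ with x∈p∪q⁻ ⁅ a ⁆ ⁅ b ⁆ e∈
    ... | inj₁ e∈a rewrite x∈⁅y⁆⇒x≡y a e∈a = a∈
    ... | inj₂ e∈b rewrite x∈⁅y⁆⇒x≡y b e∈b = b∈
    c∉ab : c ∉ ⁅ a ⁆ ∪ ⁅ b ⁆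
    c∉ab c∈ab = [ c≢a ∘ x∈⁅y⁆⇒x≡y a , c≢b ∘ x∈⁅y⁆⇒x≡y b ]′ (x∈p∪q⁻ ⁅ a ⁆ ⁅ b ⁆ c∈ab)

  At-pair-indep : ∀ {a b i} → At a i → At b i → Indep (⁅ a ⁆ ∪ ⁅ b ⁆)
  At-pair-indep a-at b-at = pair-in-leg-indep (At∈leg a-at) (At∈leg b-at) (t∈leg _) (t≢At a-at) (t≢At b-at)

  tip-pair-indep : ∀ {a c i} → At a i → At c i → a ≢ c → Indep (⁅ t ⁆ ∪ ⁅ a ⁆)
  tip-pair-indep a-at c-at a≢c =
    pair-in-leg-indep (t∈leg _) (At∈leg a-at) (At∈leg c-at) (λ c≡t → t≢At c-at (sym c≡t)) (λ c≡a → a≢c (sym c≡a))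

  ∣indep∣≤r : ∀ {J} → Indep J → ∣ J ∣ ≤ r
  ∣indep∣≤r indJ = proj₂ rank-r _ (λ _ → ∈⊤) indJ

  two≤rank : 1 ≤ r → 2 ≤ r
  two≤rank 1≤r =
    ≤-trans (≤-reflexive (cong suc (sym (∣⁅x⁆∣≡1 t)))) (≤-trans (∣p∣<∣p∪⁅y⁆∣ x∉t) (∣indep∣≤r ind))
    where
    i : Fin r
    i = fromℕ< 1≤r
    x∉t : x i ∉ ⁅ t ⁆
    x∉t x∈ = t≢x i (sym (x∈⁅y⁆⇒x≡y t x∈))
    ind : Indep (⁅ t ⁆ ∪ ⁅ x i ⁆)
    ind = tip-pair-indep (inj₁ refl) (inj₂ refl) (x≢y i i)

  -- On a hole, pick X i ∉ X; on a whole pair, unpick X i ∈ X as well.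
  pick unpick : Subset n → Fin r → Fin n
  pick X i = if does (x i ∈? X) then x i else y i
  unpick X i = if does (x i ∈? X) then y i else x i

  pick-At : ∀ X i → At (pick X i) i
  pick-At X i with x i ∈? X
  ... | yes _ = inj₁ refl
  ... | no _ = inj₂ refl

  unpick-At : ∀ X i → At (unpick X i) i
  unpick-At X i with x i ∈? X
  ... | yes _ = inj₂ refl
  ... | no _ = inj₁ refl

  pick≢unpick : ∀ X i → pick X i ≢ unpick X i
  pick≢unpick X i with x i ∈? X
  ... | yes _ = x≢y i i
  ... | no _ = λ y≡x → x≢y i i (sym y≡x)

  At-pick⊎unpick : ∀ {X e i} → At e i → e ≡ pick X i ⊎ e ≡ unpick X i
  At-pick⊎unpick {X} {i = i} = At-other (pick-At X i) (unpick-At X i) (pick≢unpick X i)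

  pick∈ : ∀ {X i} → ¬ Hole X i → pick X i ∈ X
  pick∈ {X} {i} ¬hole with x i ∈? X | y i ∈? X
  ... | yes x∈ | _ = x∈
  ... | no _ | yes y∈ = y∈
  ... | no x∉ | no y∉ = ⊥-elim (¬hole (x∉ , y∉))

  unpick∈ : ∀ {X i} → Full X i → unpick X i ∈ X
  unpick∈ {X} {i} (x∈ , y∈) with x i ∈? X
  ... | yes _ = y∈
  ... | no _ = x∈

  unpick∉ : ∀ {X i} → Single X i → unpick X i ∉ X
  unpick∉ {X} {i} single with x i ∈? X | single
  ... | yes _ | inj₁ (_ , y∉) = y∉
  ... | yes x∈ | inj₂ (x∉ , _) = ⊥-elim (x∉ x∈)
  ... | no x∉ | inj₁ (x∈ , _) = ⊥-elim (x∉ x∈)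
  ... | no _ | inj₂ (x∉ , _) = x∉

  unpick∈⇒Full : ∀ {X i} → unpick X i ∈ X → Full X i
  unpick∈⇒Full {X} {i} u∈ with x i ∈? X
  ... | yes x∈ = x∈ , u∈
  ... | no x∉ = ⊥-elim (x∉ u∈)

  pick≡⇒unpick≡ : ∀ {X Y i} → pick X i ≡ pick Y i → unpick X i ≡ unpick Y i
  pick≡⇒unpick≡ {X} {Y} {i} agree with At-pick⊎unpick {Y} (unpick-At X i)
  ... | inj₁ unpickX≡pickY = ⊥-elim (pick≢unpick X i (trans agree (sym unpickX≡pickY)))
  ... | inj₂ unpickX≡unpickY = unpickX≡unpickY

  Single-intro : ∀ {X i a b} → At a i → At b i → a ∈ X → b ∉ X → Single X i
  Single-intro (inj₁ refl) (inj₂ refl) a∈ b∉ = inj₁ (a∈ , b∉)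
  Single-intro (inj₂ refl) (inj₁ refl) a∈ b∉ = inj₂ (b∉ , a∈)
  Single-intro (inj₁ refl) (inj₁ refl) a∈ b∉ = ⊥-elim (b∉ a∈)
  Single-intro (inj₂ refl) (inj₂ refl) a∈ b∉ = ⊥-elim (b∉ a∈)

  Hole-intro : ∀ {X i a b} → At a i → At b i → a ≢ b → a ∉ X → b ∉ X → Hole X i
  Hole-intro {X} a-at b-at a≢b a∉X b∉X = ∉X (inj₁ refl) , ∉X (inj₂ refl)
    where
    ∉X : ∀ {e} → At e _ → e ∉ X
    ∉X e-at = [ (λ e≡a → subst (_∉ X) (sym e≡a) a∉X) , (λ e≡b → subst (_∉ X) (sym e≡b) b∉X) ]′
                (At-other a-at b-at a≢b e-at)

  Single-¬Hole : ∀ {X i} → Single X i → ¬ Hole X i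
  Single-¬Hole (inj₁ (x∈ , _)) (x∉ , _) = x∉ x∈
  Single-¬Hole (inj₂ (_ , y∈)) (_ , y∉) = y∉ y∈

  Single-∈ : ∀ {X i e} → Single X i → At e i → e ∈ X → e ≡ pick X i
  Single-∈ {X} single e-at e∈ with At-pick⊎unpick {X} e-at
  ... | inj₁ e≡ = e≡
  ... | inj₂ refl = ⊥-elim (unpick∉ single e∈)

  Single-∉ : ∀ {X i e} → Single X i → At e i → e ∉ X → e ≡ unpick X i
  Single-∉ {X} single e-at e∉ with At-pick⊎unpick {X} e-at
  ... | inj₁ refl = ⊥-elim (e∉ (pick∈ (Single-¬Hole single)))
  ... | inj₂ e≡ = e≡

  -- The pair i spans t, and then t and x j span y j: four elements of rank at most three.
  two-full-dependent : ∀ {i j J} → i ≢ j → Full J i → Full J j → ¬ Indep J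
  two-full-dependent {i} {j} {J} i≢j (xi∈J , yi∈J) (xj∈J , yj∈J) indJ
    with spanning-subset ((⁅ x i ⁆ ∪ ⁅ y i ⁆) ∪ ⁅ x j ⁆)
  ... | L , L⊆W , indL , L-spans-W =
    <-irrefl refl (<-≤-trans (∣p∣<∣p∪⁅y⁆∣ yj∉W)
                             (≤-trans (∣indep∣≤∣spanning∣ indL L-spans-W+t+yj W+yj⊆W+t+yj (indep-⊆ W+yj⊆J indJ))
                                      (p⊆q⇒∣p∣≤∣q∣ L⊆W)))
    where
    W : Subset n
    W = (⁅ x i ⁆ ∪ ⁅ y i ⁆) ∪ ⁅ x j ⁆
    L-spans-W+t : L Spans (W ∪ ⁅ t ⁆)
    L-spans-W+t = Spans-∪-triangle L⊆W indL L-spans-W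
      (p⊆p∪q _ (x∈p∪q⁺ (inj₁ (x∈⁅x⁆ (x i))))) (p⊆p∪q _ (x∈p∪q⁺ (inj₂ (x∈⁅x⁆ (y i)))))
      (At-pair-indep (inj₁ refl) (inj₂ refl))
      (λ J xi∈ yi∈ t∈ → leg-dependent (inj₁ refl) (inj₂ refl) (x≢y i i) t∈ xi∈ yi∈)
    L-spans-W+t+yj : L Spans ((W ∪ ⁅ t ⁆) ∪ ⁅ y j ⁆)
    L-spans-W+t+yj = Spans-∪-triangle (p⊆p∪q _ ∘ L⊆W) indL L-spans-W+t y∈p∪⁅y⁆ (p⊆p∪q _ y∈p∪⁅y⁆)
      (tip-pair-indep (inj₁ refl) (inj₂ refl) (x≢y j j))
      (λ J t∈ xj∈ yj∈ → leg-dependent (inj₁ refl) (inj₂ refl) (x≢y j j) t∈ xj∈ yj∈)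
    yj∉W : y j ∉ W
    yj∉W yj∈ with x∈p∪⁅y⁆⁻ yj∈
    ... | inj₂ y≡x = x≢y j j (sym y≡x)
    ... | inj₁ yj∈xiyi with x∈p∪q⁻ ⁅ x i ⁆ ⁅ y i ⁆ yj∈xiyi
    ...   | inj₁ y≡x = x≢y i j (sym (x∈⁅y⁆⇒x≡y _ y≡x))
    ...   | inj₂ y≡y = i≢j (sym (y-inj j i (x∈⁅y⁆⇒x≡y _ y≡y)))
    W+yj⊆W+t+yj : W ∪ ⁅ y j ⁆ ⊆ (W ∪ ⁅ t ⁆) ∪ ⁅ y j ⁆
    W+yj⊆W+t+yj = p∪⁅y⁆⊆q (p⊆p∪q _ ∘ p⊆p∪q _) y∈p∪⁅y⁆
    W+yj⊆J : W ∪ ⁅ y j ⁆ ⊆ J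
    W+yj⊆J = p∪⁅y⁆⊆q (p∪⁅y⁆⊆q (⁅x⁆∪⁅y⁆⊆p xi∈J yi∈J) xj∈J) yj∈J

  -- If neither W + x q nor W + y q were independent, W would span the leg q, hence t.
  exchange : ∀ {W q} → t ∉ W → Indep (W ∪ ⁅ t ⁆) → x q ∉ W → y q ∉ W →
    ¬ Indep (W ∪ ⁅ x q ⁆) → Indep (W ∪ ⁅ y q ⁆)
  exchange {W} {q} t∉W indW+t xq∉W yq∉W ¬indW+xq with indep? (W ∪ ⁅ y q ⁆)
  ... | yes indW+yq = indW+yq
  ... | no ¬indW+yq = ⊥-elim (W-spans-leg t y∈p∪⁅y⁆ t∉W indW+t)
    where
    W-spans : W Spans ((W ∪ ⁅ x q ⁆) ∪ ⁅ y q ⁆)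
    W-spans f f∈ f∉W with x∈p∪⁅y⁆⁻ f∈
    ... | inj₂ refl = ¬indW+yq
    ... | inj₁ f∈W+xq with x∈p∪⁅y⁆⁻ f∈W+xq
    ...   | inj₁ f∈W = ⊥-elim (f∉W f∈W)
    ...   | inj₂ refl = ¬indW+xq
    W-spans-leg : W Spans (((W ∪ ⁅ x q ⁆) ∪ ⁅ y q ⁆) ∪ ⁅ t ⁆)
    W-spans-leg = Spans-∪-triangle (p⊆p∪q _ ∘ p⊆p∪q _) (indep-⊆ (p⊆p∪q _) indW+t) W-spans
      (p⊆p∪q _ y∈p∪⁅y⁆) y∈p∪⁅y⁆
      (At-pair-indep (inj₁ refl) (inj₂ refl))
      (λ J xq∈ yq∈ t∈ → leg-dependent (inj₁ refl) (inj₂ refl) (x≢y q q) t∈ xq∈ yq∈)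

  Extra : Fin r → Subset n → Fin n → Set
  Extra h X e = e ≡ t ⊎ ∃[ p ] (p ≢ h × e ≡ unpick X p)

  module _ (2≤r : 2 ≤ r) where

    others : Fin r → List (Fin r)
    others h = filter (λ i → ¬? (i ≟ h)) (allFin r)

    Picks : Fin r → Subset n → Fin n → Subset n
    Picks h X e = ⁅ e ⁆ ∪ ⋃ (map (λ i → ⁅ pick X i ⁆) (others h))

    e∈Picks : ∀ {h X e} → e ∈ Picks h X e
    e∈Picks {e = e} = x∈p∪q⁺ (inj₁ (x∈⁅x⁆ e))

    pick∈Picks : ∀ {h X e i} → i ≢ h → pick X i ∈ Picks h X e
    pick∈Picks {h} {X} {i = i} i≢h =
      x∈p∪q⁺ (inj₂ (x∈⋃⁺ (∈-map⁺ (λ i → ⁅ pick X i ⁆) (∈-filter⁺ (λ i → ¬? (i ≟ h)) (∈-allFin i) i≢h))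
                         (x∈⁅x⁆ (pick X i))))

    ∈-Picks⁻ : ∀ {h X e f} → f ∈ Picks h X e → f ≡ e ⊎ ∃[ i ] (i ≢ h × f ≡ pick X i)
    ∈-Picks⁻ {h} {X} {e} f∈ with x∈p∪q⁻ ⁅ e ⁆ _ f∈
    ... | inj₁ f∈e = inj₁ (x∈⁅y⁆⇒x≡y e f∈e)
    ... | inj₂ f∈⋃ with x∈⋃-map⁻ {f = λ i → ⁅ pick X i ⁆} (others h) f∈⋃
    ...   | i , i∈others , f∈pick =
      inj₂ (i , proj₂ (∈-filter⁻ (λ i → ¬? (i ≟ h)) {xs = allFin r} i∈others) , x∈⁅y⁆⇒x≡y _ f∈pick)

    ∣Picks∣≤r : ∀ h X e → ∣ Picks h X e ∣ ≤ r
    ∣Picks∣≤r h X e =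
      ≤-trans (∣p∪q∣≤∣p∣+∣q∣ ⁅ e ⁆ _)
              (subst (λ k → k + _ ≤ r) (sym (∣⁅x⁆∣≡1 e))
                     (≤-trans (s≤s (∣⋃-map-⁅⁆∣≤length (pick X) (others h))) length-others<r))
      where
      length-others<r : length (others h) < r
      length-others<r = subst (length (others h) <_) (length-tabulate {n = r} (λ i → i))
        (filter-notAll (λ i → ¬? (i ≟ h)) (allFin r) (h∈ (∈-allFin h)))
        where
        h∈ : ∀ {is} → h List.∈ is → Any (λ i → ¬ ¬ i ≡ h) is
        h∈ (here refl) = here (λ i≢h → i≢h refl)
        h∈ (there h∈is) = there (h∈ h∈is)

    legs-but : Fin r → Subset n
    legs-but h = legsUnion r t x y (∁ ⁅ h ⁆)

    ∈-legs-but⁻ : ∀ {h e} → e ∈ legs-but h → ∃[ i ] (i ≢ h × e ∈ leg r t x y i)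
    ∈-legs-but⁻ {h} {e} e∈ with x∈⋃-map⁻ {f = λ i → if lookup (∁ ⁅ h ⁆) i then leg r t x y i else ⊥} (allFin r) e∈
    ... | i , _ , e∈i = in-leg i e∈i
      where
      in-leg : ∀ i → e ∈ (if lookup (∁ ⁅ h ⁆) i then leg r t x y i else ⊥) → ∃[ i ] (i ≢ h × e ∈ leg r t x y i)
      in-leg i e∈i with lookup (∁ ⁅ h ⁆) i in eq
      ... | true = i , (λ { refl → x∈∁p⇒x∉p (lookup⇒[]= i (∁ ⁅ h ⁆) eq) (x∈⁅x⁆ h) }) , e∈i
      ... | false = ⊥-elim (∉⊥ e∈i)

    legs-but-rank : ∀ h → HasRank M (legs-but h) r
    legs-but-rank h =
      subst (HasRank M (legs-but h)) (trans (cong suc ∣∁h∣) (m+[n∸m]≡n (≤-trans (n≤1+n 1) 2≤r)))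
            (unions (∁ ⁅ h ⁆) (subst (1 ≤_) (sym ∣∁h∣) (∸-monoˡ-≤ 1 2≤r)) (≤-reflexive ∣∁h∣))
      where
      ∣∁h∣ : ∣ ∁ ⁅ h ⁆ ∣ ≡ r ∸ 1
      ∣∁h∣ = trans (∣∁p∣≡n∸∣p∣ ⁅ h ⁆) (cong (r ∸_) (∣⁅x⁆∣≡1 h))

    spans-Picks⇒spans-tip : ∀ {h X e L} → Extra h X e → L ⊆ Picks h X e → Indep L → L Spans Picks h X e →
      L Spans (Picks h X e ∪ ⁅ t ⁆)
    spans-Picks⇒spans-tip (inj₁ refl) _ _ L-spans = Spans-⊆ L-spans (p∪⁅y⁆⊆q (λ f∈ → f∈) e∈Picks)
    spans-Picks⇒spans-tip {X = X} (inj₂ (p , p≢h , refl)) L⊆P indL L-spans =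
      Spans-∪-triangle L⊆P indL L-spans (pick∈Picks p≢h) e∈Picks
        (At-pair-indep (pick-At X p) (unpick-At X p))
        (λ J pick∈ unpick∈ t∈ → leg-dependent (pick-At X p) (unpick-At X p) (pick≢unpick X p) t∈ pick∈ unpick∈)

    spans-Picks⇒spans-legs : ∀ {h X e L} → Extra h X e → L ⊆ Picks h X e → Indep L → L Spans Picks h X e →
      L Spans legs-but h
    spans-Picks⇒spans-legs {h} {X} {e} {L} extra L⊆P indL L-spans-P f f∈ f∉L with ∈-legs-but⁻ f∈
    ... | i , i≢h , f∈leg with ∈-leg⁻ f∈leg
    ...   | inj₁ refl = L-spans-P+t t y∈p∪⁅y⁆ f∉L
      where
      L-spans-P+t : L Spans (Picks h X e ∪ ⁅ t ⁆)
      L-spans-P+t = spans-Picks⇒spans-tip extra L⊆P indL L-spans-P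
    ...   | inj₂ f-at with At-pick⊎unpick {X} f-at
    ...     | inj₁ refl = L-spans-P f (pick∈Picks i≢h) f∉L
    ...     | inj₂ refl =
      Spans-∪-triangle (λ f∈L → p⊆p∪q _ (L⊆P f∈L)) indL (spans-Picks⇒spans-tip extra L⊆P indL L-spans-P)
        y∈p∪⁅y⁆ (p⊆p∪q _ (pick∈Picks i≢h))
        (tip-pair-indep (pick-At X i) (unpick-At X i) (pick≢unpick X i))
        (λ J t∈ pick∈ unpick∈ → leg-dependent (pick-At X i) (unpick-At X i) (pick≢unpick X i) t∈ pick∈ unpick∈)
        f y∈p∪⁅y⁆ f∉L

    -- Anything spanning Picks h X e spans the legs other than h, which have rank r.
    Picks-basis : ∀ {h X e} → Extra h X e → Indep (Picks h X e) × r ≤ ∣ Picks h X e ∣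
    Picks-basis {h} {X} {e} extra with spanning-subset (Picks h X e)
    ... | L , L⊆P , indL , L-spans-P = indep-⊆ P⊆L indL , ≤-trans r≤∣L∣ (p⊆q⇒∣p∣≤∣q∣ L⊆P)
      where
      r≤∣L∣ : r ≤ ∣ L ∣
      r≤∣L∣ with proj₁ (legs-but-rank h)
      ... | I , I⊆ , indI , ∣I∣≡r =
        subst (_≤ ∣ L ∣) ∣I∣≡r (∣indep∣≤∣spanning∣ indL (spans-Picks⇒spans-legs extra L⊆P indL L-spans-P) I⊆ indI)
      P⊆L : Picks h X e ⊆ L
      P⊆L = p⊆q∧∣q∣≤∣p∣⇒q⊆p L⊆P (≤-trans (∣Picks∣≤r h X e) r≤∣L∣)

    Picks-⊂-dependent : ∀ {h X e J f} → Extra h X e → Picks h X e ⊆ J → f ∈ J → f ∉ Picks h X e → ¬ Indep J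
    Picks-⊂-dependent {h} {X} {e} extra P⊆J f∈J f∉P indJ =
      <-irrefl refl (<-≤-trans (≤-<-trans (proj₂ (Picks-basis extra)) (∣p∣<∣p∪⁅y⁆∣ f∉P))
                               (∣indep∣≤r (indep-⊆ (p∪⁅y⁆⊆q P⊆J f∈J) indJ)))

    -- With a hole at h, X lies inside Picks h X e for e = t, or e the unpicked element of its full pair.
    indep-if-hole : ∀ {X h} → Hole X h → (t ∈ X → ∀ i → ¬ Full X i) → (∀ i j → Full X i → Full X j → i ≡ j) → Indep X
    indep-if-hole {X} {h} hole no-tip-full full-unique with any? (Full? X)
    ... | no ¬full = indep-⊆ X⊆ (proj₁ (Picks-basis (inj₁ refl)))
      where
      X⊆ : X ⊆ Picks h X t
      X⊆ {f} f∈X with ground f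
      ... | inj₁ refl = e∈Picks
      ... | inj₂ (i , f-at) with At-pick⊎unpick {X} f-at
      ...   | inj₁ refl = pick∈Picks λ { refl → Hole-At hole f-at f∈X }
      ...   | inj₂ refl = ⊥-elim (¬full (i , unpick∈⇒Full f∈X))
    ... | yes (p , full-p) = indep-⊆ X⊆ (proj₁ (Picks-basis (inj₂ (p , p≢h , refl))))
      where
      p≢h : p ≢ h
      p≢h refl = proj₁ hole (proj₁ full-p)
      X⊆ : X ⊆ Picks h X (unpick X p)
      X⊆ {f} f∈X with ground f
      ... | inj₁ refl = ⊥-elim (no-tip-full f∈X p full-p)
      ... | inj₂ (i , f-at) with At-pick⊎unpick {X} f-at
      ...   | inj₁ refl = pick∈Picks λ { refl → Hole-At hole f-at f∈X }
      ...   | inj₂ refl with full-unique i p (unpick∈⇒Full f∈X) full-p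
      ...     | refl = e∈Picks

    pick∉Picks : ∀ {h X e} → Extra h X e → pick X h ∉ Picks h X e
    pick∉Picks {h} {X} extra p∈ with ∈-Picks⁻ p∈ | extra
    ... | inj₂ (i , i≢h , p≡) | _ = i≢h (At-unique (subst (λ f → At f i) (sym p≡) (pick-At X i)) (pick-At X h))
    ... | inj₁ refl | inj₁ p≡t = t≢At (pick-At X h) (sym p≡t)
    ... | inj₁ refl | inj₂ (p , p≢h , p≡) = p≢h (At-unique (subst (λ f → At f p) (sym p≡) (unpick-At X p)) (pick-At X h))

    dependent-if-no-hole : ∀ {X h e} → (∀ i → ¬ Hole X i) → Extra h X e → e ∈ X → ¬ Indep X
    dependent-if-no-hole {X} {h} {e} no-hole extra e∈X =
      Picks-⊂-dependent extra P⊆X (pick∈ (no-hole h)) (pick∉Picks extra)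
      where
      P⊆X : Picks h X e ⊆ X
      P⊆X f∈ with ∈-Picks⁻ f∈
      ... | inj₁ refl = e∈X
      ... | inj₂ (i , _ , refl) = pick∈ (no-hole i)

    index₀ : Fin r
    index₀ = fromℕ< (≤-trans (n≤1+n 1) 2≤r)

    another-index : ∀ p → ∃[ h ] (p ≢ h)
    another-index p with p ≟ index₀
    ... | yes refl = fromℕ< 2≤r , λ i₀≡i₁ → 0≢1 (trans (sym (toℕ-fromℕ< _)) (trans (cong toℕ i₀≡i₁) (toℕ-fromℕ< _)))
      where
      0≢1 : 0 ≢ 1
      0≢1 ()
    ... | no p≢i₀ = index₀ , p≢i₀

    indep-full-unique : ∀ {X} → Indep X → ∀ i j → Full X i → Full X j → i ≡ j
    indep-full-unique indX i j full-i full-j with i ≟ j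
    ... | yes i≡j = i≡j
    ... | no i≢j = ⊥-elim (two-full-dependent i≢j full-i full-j indX)

    indep-no-tip-full : ∀ {X} → Indep X → t ∈ X → ∀ i → ¬ Full X i
    indep-no-tip-full indX t∈X i (x∈ , y∈) = leg-dependent (inj₁ refl) (inj₂ refl) (x≢y i i) t∈X x∈ y∈ indX

    Full-∪-hole : ∀ {X i j} → Hole X i → Full (X ∪ ⁅ x i ⁆) j → Full X j
    Full-∪-hole {X} {i} {j} (_ , yi∉) (xj∈ , yj∈) with x∈p∪⁅y⁆⁻ yj∈
    ... | inj₂ y≡x = ⊥-elim (x≢y i j (sym y≡x))
    ... | inj₁ yj∈X with x∈p∪⁅y⁆⁻ xj∈
    ...   | inj₁ xj∈X = xj∈X , yj∈X
    ...   | inj₂ x≡x rewrite x-inj j i x≡x = ⊥-elim (yi∉ yj∈X)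

    basis-hole-unique : ∀ {A h i} → Basis M A → Hole A h → Hole A i → h ≡ i
    basis-hole-unique {A} {h} {i} (indA , maximal) hole-h hole-i with h ≟ i
    ... | yes h≡i = h≡i
    ... | no h≢i = ⊥-elim (proj₁ hole-i (maximal _ indA+xi (p⊆p∪q _) y∈p∪⁅y⁆))
      where
      hole-h′ : Hole (A ∪ ⁅ x i ⁆) h
      hole-h′ = (λ xh∈ → [ proj₁ hole-h , (λ x≡x → h≢i (x-inj h i x≡x)) ]′ (x∈p∪⁅y⁆⁻ xh∈))
              , (λ yh∈ → [ proj₂ hole-h , (λ y≡x → x≢y i h (sym y≡x)) ]′ (x∈p∪⁅y⁆⁻ yh∈))
      indA+xi : Indep (A ∪ ⁅ x i ⁆)
      indA+xi = indep-if-hole hole-h′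
        (λ t∈ j full → indep-no-tip-full indA ([ (λ t∈A → t∈A) , (λ t≡x → ⊥-elim (t≢x i t≡x)) ]′ (x∈p∪⁅y⁆⁻ t∈)) j
                                          (Full-∪-hole hole-i full))
        (λ j k full-j full-k → indep-full-unique indA j k (Full-∪-hole hole-i full-j) (Full-∪-hole hole-i full-k))

  data Shape (A : Subset n) : Set where
    tipped : ∀ h → t ∈ A → Hole A h → (∀ i → i ≢ h → Single A i) → Shape A
    doubled : ∀ p h → p ≢ h → t ∉ A → Full A p → Hole A h → (∀ i → i ≢ h → i ≢ p → Single A i) → Shape A
    transversal : t ∉ A → (∀ i → Single A i) → Shape A

  shape : 2 ≤ r → ∀ {A} → Basis M A → Shape A
  shape 2≤r {A} basis@(indA , maximal) with t ∈? A | any? (Full? A) | any? (Hole? A)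
  ... | yes t∈A | _ | no ¬hole =
    ⊥-elim (dependent-if-no-hole 2≤r {h = index₀ 2≤r} (λ i hole → ¬hole (i , hole)) (inj₁ refl) t∈A indA)
  ... | yes t∈A | _ | yes (h , hole) =
    tipped h t∈A hole λ i i≢h → Single-if-¬Hole-¬Full (λ hole-i → i≢h (sym (basis-hole-unique 2≤r basis hole hole-i)))
                                                     (indep-no-tip-full 2≤r indA t∈A i)
  ... | no t∉A | yes (p , full) | no ¬hole =
    ⊥-elim (dependent-if-no-hole 2≤r {h = proj₁ (another-index 2≤r p)} (λ i hole → ¬hole (i , hole))
                                 (inj₂ (p , proj₂ (another-index 2≤r p) , refl)) (unpick∈ full) indA)
  ... | no t∉A | yes (p , full) | yes (h , hole) =
    doubled p h (λ { refl → proj₁ hole (proj₁ full) }) t∉A full hole λ i i≢h i≢p →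
      Single-if-¬Hole-¬Full (λ hole-i → i≢h (sym (basis-hole-unique 2≤r basis hole hole-i)))
                            (λ full-i → i≢p (indep-full-unique 2≤r indA i p full-i full))
  ... | no t∉A | no ¬full | yes (h , hole) = ⊥-elim (t∉A (maximal _ indA+t (p⊆p∪q _) y∈p∪⁅y⁆))
    where
    indA+t : Indep (A ∪ ⁅ t ⁆)
    indA+t = indep-if-hole 2≤r (Hole-∪-tip hole)
      (λ _ j full → ¬full (j , Full-∪-tip full)) (λ j _ full _ → ⊥-elim (¬full (j , Full-∪-tip full)))
  ... | no t∉A | no ¬full | no ¬hole =
    transversal t∉A λ i → Single-if-¬Hole-¬Full (λ hole → ¬hole (i , hole)) (λ full → ¬full (i , full))

module BasisPair {n r : ℕ} {t : Fin n} {x y : Fin r → Fin n} {M : Matroid n} (S : IsSpike r t x y M) (2≤r : 2 ≤ r)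
                 (A B : Subset n) (indA : Matroid.Indep M A) (indB : Matroid.Indep M B) where
  open Matroid M
  open IsSpike S
  open Spike S
  open Ladder M A B

  Δ : Subset n
  Δ = (A ─ B) ∪ (B ─ A)

  in-A⇒∉B : ∀ {e} → e ∈ Δ → e ∈ A → e ∉ B
  in-A⇒∉B e∈Δ e∈A e∈B =
    [ (λ e∈A─B → x∈p─q⇒x∉q e∈A─B e∈B) , (λ e∈B─A → x∈p─q⇒x∉q e∈B─A e∈A) ]′ (x∈p∪q⁻ (A ─ B) (B ─ A) e∈Δ)

  in-B⇒∉A : ∀ {e} → e ∈ Δ → e ∈ B → e ∉ A
  in-B⇒∉A e∈Δ e∈B e∈A = in-A⇒∉B e∈Δ e∈A e∈B

  ∉A⇒in-B : ∀ {e} → e ∈ Δ → e ∉ A → e ∈ B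
  ∉A⇒in-B e∈Δ = x∈p∪q∧x∉p⇒x∈q (p─q∪q─p⊆p∪q e∈Δ)

  ∉B⇒in-A : ∀ {e} → e ∈ Δ → e ∉ B → e ∈ A
  ∉B⇒in-A e∈Δ = x∈p∪q∧x∉p⇒x∈q (x∈p∪q⇒x∈q∪p (p─q∪q─p⊆p∪q e∈Δ))

  Swap : Fin r → Set
  Swap i = pick A i ∈ A ─ B × unpick A i ∈ B ─ A

  Swap? : ∀ i → Dec (Swap i)
  Swap? i = (pick A i ∈? A ─ B) ×-dec (unpick A i ∈? B ─ A)

  Swap⇒Single : ∀ {i} → Swap i → Single A i × Single B i
  Swap⇒Single {i} (pick∈A─B , unpick∈B─A) =
    Single-intro (pick-At A i) (unpick-At A i) (p─q⊆p A B pick∈A─B) (x∈p─q⇒x∉q unpick∈B─A) ,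
    Single-intro (unpick-At A i) (pick-At A i) (p─q⊆p B A unpick∈B─A) (x∈p─q⇒x∉q pick∈A─B)

  agree⊎Swap : ∀ {i} → Single A i → Single B i → pick A i ≡ pick B i ⊎ Swap i
  agree⊎Swap {i} single-A single-B with pick A i ≟ pick B i
  ... | yes agree = inj₁ agree
  ... | no disagree with At-pick⊎unpick {B} (pick-At A i) | At-pick⊎unpick {B} (unpick-At A i)
  ...   | inj₁ agree | _ = ⊥-elim (disagree agree)
  ...   | inj₂ pickA≡unpickB | inj₂ unpickA≡unpickB = ⊥-elim (pick≢unpick A i (trans pickA≡unpickB (sym unpickA≡unpickB)))
  ...   | inj₂ pickA≡unpickB | inj₁ unpickA≡pickB =
    inj₂ (x∈p∧x∉q⇒x∈p─q (pick∈ (Single-¬Hole single-A)) (subst (_∉ B) (sym pickA≡unpickB) (unpick∉ single-B)) ,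
          x∈p∧x∉q⇒x∈p─q (subst (_∈ B) (sym unpickA≡pickB) (pick∈ (Single-¬Hole single-B))) (unpick∉ single-A))

  unpick∉A∪B-if-agree : ∀ {i} → Single A i → Single B i → pick A i ≡ pick B i → unpick A i ∉ A ∪ B
  unpick∉A∪B-if-agree {i} single-A single-B agree unpick∈ =
    [ unpick∉ single-A , unpick∉ single-B ∘ subst (_∈ B) (pick≡⇒unpick≡ agree) ]′ (x∈p∪q⁻ A B unpick∈)

  unswapped-∉Δ : ∀ {i e} → Single A i → Single B i → ¬ Swap i → At e i → e ∉ Δ
  unswapped-∉Δ {i} single-A single-B ¬swap e-at e∈Δ with agree⊎Swap single-A single-B
  ... | inj₂ swap = ¬swap swap
  ... | inj₁ agree with At-pick⊎unpick {A} e-at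
  ...   | inj₁ refl = in-A⇒∉B e∈Δ (pick∈ (Single-¬Hole single-A)) (subst (_∈ B) (sym agree) (pick∈ (Single-¬Hole single-B)))
  ...   | inj₂ refl = unpick∉A∪B-if-agree single-A single-B agree (p─q∪q─p⊆p∪q e∈Δ)

  Full-unswapped : ∀ {X i} → X ⊆ A ∪ B → Full X i → ¬ Swap i → Full A i ⊎ Full B i
  Full-unswapped {X} {i} X⊆A∪B full ¬swap with Full? A i | Full? B i
  ... | yes full-A | _ = inj₁ full-A
  ... | no _ | yes full-B = inj₂ full-B
  ... | no ¬full-A | no ¬full-B =
    [ (λ agree → ⊥-elim (unpick∉A∪B-if-agree single-A single-B agree (in-A∪B (unpick-At A i)))) , (⊥-elim ∘ ¬swap) ]′
      (agree⊎Swap single-A single-B)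
    where
    in-A∪B : ∀ {e} → At e i → e ∈ A ∪ B
    in-A∪B e-at = X⊆A∪B (Full-At full e-at)
    single-A : Single A i
    single-A = Single-if-¬Hole-¬Full
      (λ (x∉ , y∉) → ¬full-B (x∈p∪q∧x∉p⇒x∈q (in-A∪B (inj₁ refl)) x∉ , x∈p∪q∧x∉p⇒x∈q (in-A∪B (inj₂ refl)) y∉))
      ¬full-A
    single-B : Single B i
    single-B = Single-if-¬Hole-¬Full
      (λ (x∉ , y∉) → ¬full-A (x∈p∪q∧x∉p⇒x∈q (x∈p∪q⇒x∈q∪p (in-A∪B (inj₁ refl))) x∉ ,
                               x∈p∪q∧x∉p⇒x∈q (x∈p∪q⇒x∈q∪p (in-A∪B (inj₂ refl))) y∉)) ¬full-B

  swapRung : Fin r → Fin n × Fin n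
  swapRung i = unpick A i , pick A i

  swapRungs : List (Fin n × Fin n)
  swapRungs = map swapRung (filter Swap? (allFin r))

  SwapRung : Fin n × Fin n → Set
  SwapRung ba = ∃[ i ] (Swap i × ba ≡ swapRung i)

  swapRungs-SwapRung : All SwapRung swapRungs
  swapRungs-SwapRung = All.map⁺ (All.map (λ {i} swap → i , swap , refl) (All.all-filter Swap? (allFin r)))

  SwapRung-Rung : ∀ {ba} → SwapRung ba → Rung ba
  SwapRung-Rung (_ , (pick∈ , unpick∈) , refl) = unpick∈ , pick∈

  swapRung∈ : ∀ {i} → Swap i → swapRung i List.∈ swapRungs
  swapRung∈ {i} swap = ∈-map⁺ swapRung (∈-filter⁺ Swap? (∈-allFin i) swap)

  missed-swap-hole : ∀ {X R} → All SwapRung R → Any (Misses X) R → ∃[ i ] Hole X i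
  missed-swap-hole ((i , _ , refl) ∷ _) (here (unpick∉ , pick∉)) =
    i , Hole-intro (pick-At A i) (unpick-At A i) (pick≢unpick A i) pick∉ unpick∉
  missed-swap-hole (_ ∷ swap-rungs) (there missed) = missed-swap-hole swap-rungs missed

  NotSwap : Fin n → Set
  NotSwap e = e ≡ t ⊎ ∃[ i ] (At e i × ¬ Swap i)

  NotSwap-At : ∀ {e i} → NotSwap e → Swap i → ¬ At e i
  NotSwap-At (inj₁ refl) _ t-at = t≢At t-at refl
  NotSwap-At (inj₂ (j , e-at-j , ¬swap-j)) swap-i e-at-i with At-unique e-at-i e-at-j
  ... | refl = ¬swap-j swap-i

  NotSwap-∉ : ∀ {e R} → All SwapRung R → NotSwap e → e List.∉ rungs R
  NotSwap-∉ ((i , swap , refl) ∷ _) not-swap (here refl) = NotSwap-At not-swap swap (unpick-At A i)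
  NotSwap-∉ ((i , swap , refl) ∷ _) not-swap (there (here refl)) = NotSwap-At not-swap swap (pick-At A i)
  NotSwap-∉ (_ ∷ swap-rungs) not-swap (there (there e∈)) = NotSwap-∉ swap-rungs not-swap e∈

  NotSwap-A : ∀ {i e} → ¬ Single A i → At e i → NotSwap e
  NotSwap-A {i} ¬single e-at = inj₂ (i , e-at , λ swap → ¬single (proj₁ (Swap⇒Single swap)))

  NotSwap-B : ∀ {i e} → ¬ Single B i → At e i → NotSwap e
  NotSwap-B {i} ¬single e-at = inj₂ (i , e-at , λ swap → ¬single (proj₂ (Swap⇒Single swap)))

  swap-∈-rungs : ∀ {i e} → Swap i → At e i → e List.∈ rungs swapRungs
  swap-∈-rungs {i} swap e-at with At-pick⊎unpick {A} e-at
  ... | inj₁ refl = proj₂ (∈-rungs (swapRung∈ swap))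
  ... | inj₂ refl = proj₁ (∈-rungs (swapRung∈ swap))

  Unique-swapRungs : Unique (rungs swapRungs)
  Unique-swapRungs = go (Unique.filter⁺ Swap? (Unique.allFin⁺ r))
    where
    At-∉ : ∀ {e i} → At e i → ∀ {is} → All (i ≢_) is → All (e ≢_) (rungs (map swapRung is))
    At-∉ e-at [] = []
    At-∉ e-at {j ∷ _} (i≢j ∷ i≢is) = At-≢ e-at (unpick-At A j) i≢j ∷ At-≢ e-at (pick-At A j) i≢j ∷ At-∉ e-at i≢is
    go : ∀ {is} → Unique is → Unique (rungs (map swapRung is))
    go [] = []
    go {i ∷ _} (i∉ ∷ unique) = (≢-sym (pick≢unpick A i) ∷ At-∉ (unpick-At A i) i∉) ∷ At-∉ (pick-At A i) i∉ ∷ go unique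

  FullInAB : Subset n → Set
  FullInAB X = ∀ {i} → Full X i → Full A i ⊎ Full B i

  stable-Full : ∀ {X ma K mb} → X ⊆ A ∪ B → Stable (ladder ma (K ++ swapRungs) mb) X → FullInAB X
  stable-Full {X} {ma} {K} {mb} X⊆A∪B stable {i} full with Swap? i
  ... | no ¬swap = Full-unswapped X⊆A∪B full ¬swap
  ... | yes swap = ⊥-elim (stable (rung-consecutive {ma = ma} {bas = K ++ swapRungs} {mb = mb} (∈-++⁺ʳ K (swapRung∈ swap)))
                                  (Full-At full (unpick-At A i)) (Full-At full (pick-At A i)))

  Covers : Maybe (Fin n) → List (Fin n × Fin n) → Maybe (Fin n) → Set
  Covers ma K mb = ∀ {e} → e ∈ Δ → NotSwap e → e List.∈ ladder ma K mb

  StableIndep : Maybe (Fin n) → List (Fin n × Fin n) → Maybe (Fin n) → Set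
  StableIndep ma K mb = ∀ X → X ⊆ A ∪ B → Stable (ladder ma (K ++ swapRungs) mb) X → FullInAB X →
    Any (Misses X) K ⊎ (∃[ i ] Hole X i) ⊎ (Maybe.All (_∉ X) ma × Maybe.All (_∉ X) mb) → Indep X

  -- The paths below consist of a few rungs K and ends, made of the elements of Δ outside swap
  -- pairs, followed by the swap rungs; a stable set that misses a swap rung has a hole there.
  swapLadder-goodPath : ∀ {ma K mb} →
    Maybe.All (_∈ A ─ B) ma → All Rung K → Maybe.All (_∈ B ─ A) mb →
    Unique (ladder ma K mb) → All NotSwap (ladder ma K mb) → Covers ma K mb → StableIndep ma K mb →
    ∃[ p ] GoodPath M A B p
  swapLadder-goodPath {ma} {K} {mb} start middle end unique not-swaps covers stable-indep =
    ladder ma (K ++ swapRungs) mb ,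
    ladder-goodPath indA indB start (All.++⁺ middle (All.map SwapRung-Rung swapRungs-SwapRung)) end
      (Unique-ladder-++ ma K mb swapRungs unique Unique-swapRungs (λ e∈ → NotSwap-∉ swapRungs-SwapRung (All.lookup not-swaps e∈)))
      covers-all obligation
    where
    covers-all : ∀ e → e ∈ Δ → e List.∈ ladder ma (K ++ swapRungs) mb
    covers-all e e∈Δ with ground e
    ... | inj₁ refl = ∈-ladder-++ˡ ma K mb swapRungs (covers e∈Δ (inj₁ refl))
    ... | inj₂ (i , e-at) with Swap? i
    ...   | yes swap = ∈-ladder-++ʳ ma K mb swapRungs (swap-∈-rungs swap e-at)
    ...   | no ¬swap = ∈-ladder-++ˡ ma K mb swapRungs (covers e∈Δ (inj₂ (i , e-at , ¬swap)))
    obligation : ∀ X → X ⊆ A ∪ B → Stable (ladder ma (K ++ swapRungs) mb) X →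
      Any (Misses X) (K ++ swapRungs) ⊎ (Maybe.All (_∉ X) ma × Maybe.All (_∉ X) mb) → Indep X
    obligation X X⊆A∪B stable missed =
      stable-indep X X⊆A∪B stable (stable-Full {ma = ma} {K = K} X⊆A∪B stable) (split missed)
      where
      split : Any (Misses X) (K ++ swapRungs) ⊎ (Maybe.All (_∉ X) ma × Maybe.All (_∉ X) mb) →
        Any (Misses X) K ⊎ (∃[ i ] Hole X i) ⊎ (Maybe.All (_∉ X) ma × Maybe.All (_∉ X) mb)
      split (inj₁ missed) = Data.Sum.map₂ (inj₁ ∘ missed-swap-hole swapRungs-SwapRung) (Any.++⁻ K missed)
      split (inj₂ ends) = inj₂ (inj₂ ends)

  Δ-hole-single : ∀ {i e} → Hole A i → Single B i → At e i → e ∈ Δ → e ≡ pick B i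
  Δ-hole-single hole single e-at e∈Δ = Single-∈ single e-at (∉A⇒in-B e∈Δ (Hole-At hole e-at))

  Δ-single-hole : ∀ {i e} → Single A i → Hole B i → At e i → e ∈ Δ → e ≡ pick A i
  Δ-single-hole single hole e-at e∈Δ = Single-∈ single e-at (∉B⇒in-A e∈Δ (Hole-At hole e-at))

  Δ-single-full : ∀ {i e} → Single A i → Full B i → At e i → e ∈ Δ → e ≡ unpick A i
  Δ-single-full single full e-at e∈Δ = Single-∉ single e-at (in-B⇒∉A e∈Δ (Full-At full e-at))

  Δ-full-single : ∀ {i e} → Full A i → Single B i → At e i → e ∈ Δ → e ≡ unpick B i
  Δ-full-single full single e-at e∈Δ = Single-∉ single e-at (in-A⇒∉B e∈Δ (Full-At full e-at))

  Δ-hole-hole : ∀ {i e} → Hole A i → Hole B i → At e i → e ∉ Δ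
  Δ-hole-hole hole-A hole-B e-at e∈Δ = Hole-At hole-B e-at (∉A⇒in-B e∈Δ (Hole-At hole-A e-at))

  Δ-full-full : ∀ {i e} → Full A i → Full B i → At e i → e ∉ Δ
  Δ-full-full full-A full-B e-at e∈Δ = in-A⇒∉B e∈Δ (Full-At full-A e-at) (Full-At full-B e-at)

  pick-B-side : ∀ {i} → Hole A i → Single B i → pick B i ∈ B ─ A
  pick-B-side {i} hole single = x∈p∧x∉q⇒x∈p─q (pick∈ (Single-¬Hole single)) (Hole-At hole (pick-At B i))

  pick-A-side : ∀ {i} → Single A i → Hole B i → pick A i ∈ A ─ B
  pick-A-side {i} single hole = x∈p∧x∉q⇒x∈p─q (pick∈ (Single-¬Hole single)) (Hole-At hole (pick-At A i))

  unpick-A-side : ∀ {i} → Single A i → Full B i → unpick A i ∈ B ─ A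
  unpick-A-side {i} single full = x∈p∧x∉q⇒x∈p─q (Full-At full (unpick-At A i)) (unpick∉ single)

  unpick-B-side : ∀ {i} → Full A i → Single B i → unpick B i ∈ A ─ B
  unpick-B-side {i} full single = x∈p∧x∉q⇒x∈p─q (Full-At full (unpick-At B i)) (unpick∉ single)

  OnlyAt : Fin r → Fin n → Set
  OnlyAt i f = ∀ {e} → At e i → e ∈ A ∪ B → e ≡ f

  only-hole-single : ∀ {i} → Hole A i → Single B i → OnlyAt i (pick B i)
  only-hole-single hole single e-at e∈ = Single-∈ single e-at (x∈p∪q∧x∉p⇒x∈q e∈ (Hole-At hole e-at))

  only-single-hole : ∀ {i} → Single A i → Hole B i → OnlyAt i (pick A i)
  only-single-hole single hole e-at e∈ = Single-∈ single e-at (x∈p∪q∧x∉p⇒x∈q (x∈p∪q⇒x∈q∪p e∈) (Hole-At hole e-at))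

  hole-if-only : ∀ {X i f} → X ⊆ A ∪ B → OnlyAt i f → f ∉ X → Hole X i
  hole-if-only X⊆A∪B only f∉X =
    (λ x∈X → f∉X (subst (_∈ _) (only (inj₁ refl) (X⊆A∪B x∈X)) x∈X)) ,
    (λ y∈X → f∉X (subst (_∈ _) (only (inj₂ refl) (X⊆A∪B y∈X)) y∈X))

  hole-if-only-edge : ∀ {X i j u v} → X ⊆ A ∪ B → OnlyAt i u → OnlyAt j v → (u ∈ X → v ∉ X) → ∃[ h ] Hole X h
  hole-if-only-edge {X} {i} {j} {u} X⊆A∪B only-u only-v edge with u ∈? X
  ... | yes u∈X = j , hole-if-only X⊆A∪B only-v (edge u∈X)
  ... | no u∉X = i , hole-if-only X⊆A∪B only-u u∉X

  hole-if-hole-hole : ∀ {X i} → X ⊆ A ∪ B → Hole A i → Hole B i → Hole X i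
  hole-if-hole-hole X⊆A∪B hole-A hole-B =
    (λ x∈X → [ proj₁ hole-A , proj₁ hole-B ]′ (x∈p∪q⁻ A B (X⊆A∪B x∈X))) ,
    (λ y∈X → [ proj₂ hole-A , proj₂ hole-B ]′ (x∈p∪q⁻ A B (X⊆A∪B y∈X)))

  hole-from-end : ∀ {X ma i b} → X ⊆ A ∪ B → OnlyAt i b →
    Any (Misses X) [] ⊎ (∃[ h ] Hole X h) ⊎ (Maybe.All (_∉ X) ma × Maybe.All (_∉ X) (just b)) → ∃[ h ] Hole X h
  hole-from-end _ _ (inj₁ ())
  hole-from-end _ _ (inj₂ (inj₁ hole)) = hole
  hole-from-end {i = i} X⊆A∪B only (inj₂ (inj₂ (_ , just b∉X))) = i , hole-if-only X⊆A∪B only b∉X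

  tip∉ : ∀ {X} → t ∉ A → t ∉ B → X ⊆ A ∪ B → t ∉ X
  tip∉ t∉A t∉B X⊆A∪B t∈X = [ t∉A , t∉B ]′ (x∈p∪q⁻ A B (X⊆A∪B t∈X))

  full-unique-at : ∀ {X p} → (∀ {i} → Full X i → i ≡ p) → ∀ i j → Full X i → Full X j → i ≡ j
  full-unique-at at-p i j full-i full-j = trans (at-p full-i) (sym (at-p full-j))

  Full-at-∈ : ∀ {X i j e} → Full X i → i ≡ j → At e j → e ∈ X
  Full-at-∈ full refl e-at = Full-At full e-at

  indep-if-some-hole : ∀ {X} → ∃[ h ] Hole X h → (t ∈ X → ∀ i → ¬ Full X i) →
    (∀ i j → Full X i → Full X j → i ≡ j) → Indep X
  indep-if-some-hole (h , hole) = indep-if-hole 2≤r hole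

  module _ {hA hB} (t∈A : t ∈ A) (hole-A : Hole A hA) (single-A : ∀ i → i ≢ hA → Single A i)
                   (t∈B : t ∈ B) (hole-B : Hole B hB) (single-B : ∀ i → i ≢ hB → Single B i) where

    private
      ¬full : ∀ {X i} → FullInAB X → ¬ Full X i
      ¬full full-AB full = [ ¬Full-tipped hole-A single-A , ¬Full-tipped hole-B single-B ]′ (full-AB full)

    tipped-tipped-≡ : hA ≡ hB → ∃[ p ] GoodPath M A B p
    tipped-tipped-≡ refl = swapLadder-goodPath nothing [] nothing [] [] covers stable-indep
      where
      covers : Covers nothing [] nothing
      covers e∈Δ (inj₁ refl) = ⊥-elim (in-A⇒∉B e∈Δ t∈A t∈B)
      covers e∈Δ (inj₂ (i , e-at , ¬swap)) with i ≟ hA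
      ... | yes refl = ⊥-elim (Δ-hole-hole hole-A hole-B e-at e∈Δ)
      ... | no i≢h = ⊥-elim (unswapped-∉Δ (single-A i i≢h) (single-B i i≢h) ¬swap e-at e∈Δ)
      stable-indep : StableIndep nothing [] nothing
      stable-indep X X⊆A∪B stable full-AB _ =
        indep-if-hole 2≤r (hole-if-hole-hole X⊆A∪B hole-A hole-B)
          (λ _ _ → ¬full full-AB) (λ _ _ full _ → ⊥-elim (¬full full-AB full))

    tipped-tipped-≢ : hA ≢ hB → ∃[ p ] GoodPath M A B p
    tipped-tipped-≢ hA≢hB =
      swapLadder-goodPath nothing ((pick-B-side hole-A single-B-hA , pick-A-side single-A-hB hole-B) ∷ []) nothing
        ((At-≢ (pick-At B hA) (pick-At A hB) hA≢hB ∷ []) ∷ [] ∷ [])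
        (NotSwap-A (Hole-¬Single hole-A) (pick-At B hA) ∷ NotSwap-B (Hole-¬Single hole-B) (pick-At A hB) ∷ [])
        covers stable-indep
      where
      single-B-hA : Single B hA
      single-B-hA = single-B hA hA≢hB
      single-A-hB : Single A hB
      single-A-hB = single-A hB (≢-sym hA≢hB)
      K : List (Fin n × Fin n)
      K = (pick B hA , pick A hB) ∷ []
      covers : Covers nothing K nothing
      covers e∈Δ (inj₁ refl) = ⊥-elim (in-A⇒∉B e∈Δ t∈A t∈B)
      covers e∈Δ (inj₂ (i , e-at , ¬swap)) with i ≟ hA | i ≟ hB
      ... | yes refl | _ = here (Δ-hole-single hole-A single-B-hA e-at e∈Δ)
      ... | no _ | yes refl = there (here (Δ-single-hole single-A-hB hole-B e-at e∈Δ))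
      ... | no i≢hA | no i≢hB = ⊥-elim (unswapped-∉Δ (single-A i i≢hA) (single-B i i≢hB) ¬swap e-at e∈Δ)
      stable-indep : StableIndep nothing K nothing
      stable-indep X X⊆A∪B stable full-AB _ =
        indep-if-some-hole (hole-if-only-edge X⊆A∪B (only-hole-single hole-A single-B-hA) (only-single-hole single-A-hB hole-B) (stable here))
          (λ _ _ → ¬full full-AB) (λ _ _ full _ → ⊥-elim (¬full full-AB full))

    tipped-tipped : ∃[ p ] GoodPath M A B p
    tipped-tipped with hA ≟ hB
    ... | yes hA≡hB = tipped-tipped-≡ hA≡hB
    ... | no hA≢hB = tipped-tipped-≢ hA≢hB

  module _ {hA pB hB} (t∈A : t ∈ A) (hole-A : Hole A hA) (single-A : ∀ i → i ≢ hA → Single A i)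
                      (pB≢hB : pB ≢ hB) (t∉B : t ∉ B) (full-B : Full B pB) (hole-B : Hole B hB)
                      (single-B : ∀ i → i ≢ hB → i ≢ pB → Single B i) where

    private
      full-at-pB : ∀ {X i} → FullInAB X → Full X i → i ≡ pB
      full-at-pB full-AB full = [ (λ full-A → ⊥-elim (¬Full-tipped hole-A single-A full-A)) , Full-doubled hole-B single-B ]′ (full-AB full)

      t∈A─B : t ∈ A ─ B
      t∈A─B = x∈p∧x∉q⇒x∈p─q t∈A t∉B

    tipped-doubled-≡ : hA ≡ hB → ∃[ p ] GoodPath M A B p
    tipped-doubled-≡ refl =
      swapLadder-goodPath nothing ((unpick-A-side single-A-pB full-B , t∈A─B) ∷ []) nothing
        ((≢-sym (t≢At (unpick-At A pB)) ∷ []) ∷ [] ∷ [])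
        (NotSwap-B (Full-¬Single full-B) (unpick-At A pB) ∷ inj₁ refl ∷ [])
        covers stable-indep
      where
      single-A-pB : Single A pB
      single-A-pB = single-A pB pB≢hB
      K : List (Fin n × Fin n)
      K = (unpick A pB , t) ∷ []
      covers : Covers nothing K nothing
      covers e∈Δ (inj₁ refl) = there (here refl)
      covers e∈Δ (inj₂ (i , e-at , ¬swap)) with i ≟ hA | i ≟ pB
      ... | yes refl | _ = ⊥-elim (Δ-hole-hole hole-A hole-B e-at e∈Δ)
      ... | no _ | yes refl = here (Δ-single-full single-A-pB full-B e-at e∈Δ)
      ... | no i≢h | no i≢pB = ⊥-elim (unswapped-∉Δ (single-A i i≢h) (single-B i i≢h i≢pB) ¬swap e-at e∈Δ)
      stable-indep : StableIndep nothing K nothing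
      stable-indep X X⊆A∪B stable full-AB _ =
        indep-if-hole 2≤r (hole-if-hole-hole X⊆A∪B hole-A hole-B)
          (λ t∈X i full → stable here (Full-at-∈ full (full-at-pB full-AB full) (unpick-At A pB)) t∈X)
          (full-unique-at (full-at-pB full-AB))

    tipped-doubled-hole≡full : hA ≢ hB → hA ≡ pB → ∃[ p ] GoodPath M A B p
    tipped-doubled-hole≡full hA≢hB refl =
      swapLadder-goodPath nothing
        ((x∈p∧x∉q⇒x∈p─q (proj₁ full-B) (proj₁ hole-A) , pick-A-side single-A-hB hole-B) ∷
         (x∈p∧x∉q⇒x∈p─q (proj₂ full-B) (proj₂ hole-A) , t∈A─B) ∷ []) nothing
        ((At-≢ (inj₁ refl) (pick-At A hB) hA≢hB ∷ x≢y q q ∷ ≢-sym (t≢At (inj₁ refl)) ∷ []) ∷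
         (At-≢ (pick-At A hB) (inj₂ refl) (≢-sym hA≢hB) ∷ ≢-sym (t≢At (pick-At A hB)) ∷ []) ∷
         (≢-sym (t≢At (inj₂ refl)) ∷ []) ∷ [] ∷ [])
        (NotSwap-A (Hole-¬Single hole-A) (inj₁ refl) ∷ NotSwap-B (Hole-¬Single hole-B) (pick-At A hB) ∷
         NotSwap-A (Hole-¬Single hole-A) (inj₂ refl) ∷ inj₁ refl ∷ [])
        covers stable-indep
      where
      q : Fin r
      q = hA
      single-A-hB : Single A hB
      single-A-hB = single-A hB (≢-sym hA≢hB)
      a : Fin n
      a = pick A hB
      K : List (Fin n × Fin n)
      K = (x q , a) ∷ (y q , t) ∷ []
      covers : Covers nothing K nothing
      covers e∈Δ (inj₁ refl) = there (there (there (here refl)))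
      covers e∈Δ (inj₂ (i , e-at , ¬swap)) with i ≟ q | i ≟ hB
      ... | yes refl | _ = [ here , (λ e≡y → there (there (here e≡y))) ]′ e-at
      ... | no _ | yes refl = there (here (Δ-single-hole single-A-hB hole-B e-at e∈Δ))
      ... | no i≢q | no i≢hB = ⊥-elim (unswapped-∉Δ (single-A i i≢q) (single-B i i≢hB i≢q) ¬swap e-at e∈Δ)
      hole : ∀ {X} → X ⊆ A ∪ B → Stable (ladder nothing (K ++ swapRungs) nothing) X → ∃[ h ] Hole X h
      hole {X} X⊆A∪B stable with a ∈? X
      ... | yes a∈X = q , (λ x∈X → stable here x∈X a∈X) , stable (there here) a∈X
      ... | no a∉X = hB , hole-if-only X⊆A∪B (only-single-hole single-A-hB hole-B) a∉X
      stable-indep : StableIndep nothing K nothing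
      stable-indep X X⊆A∪B stable full-AB _ =
        indep-if-some-hole (hole X⊆A∪B stable)
          (λ t∈X i full → stable (there (there here)) (Full-at-∈ full (full-at-pB full-AB full) (inj₂ refl)) t∈X)
          (full-unique-at (full-at-pB full-AB))

    tipped-doubled-distinct : hA ≢ hB → hA ≢ pB → ∃[ p ] GoodPath M A B p
    tipped-doubled-distinct hA≢hB hA≢pB =
      swapLadder-goodPath nothing
        ((pick-B-side hole-A single-B-hA , pick-A-side single-A-hB hole-B) ∷ (unpick-A-side single-A-pB full-B , t∈A─B) ∷ []) nothing
        ((At-≢ (pick-At B hA) (pick-At A hB) hA≢hB ∷ At-≢ (pick-At B hA) (unpick-At A pB) hA≢pB ∷
          ≢-sym (t≢At (pick-At B hA)) ∷ []) ∷
         (At-≢ (pick-At A hB) (unpick-At A pB) (≢-sym pB≢hB) ∷ ≢-sym (t≢At (pick-At A hB)) ∷ []) ∷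
         (≢-sym (t≢At (unpick-At A pB)) ∷ []) ∷ [] ∷ [])
        (NotSwap-A (Hole-¬Single hole-A) (pick-At B hA) ∷ NotSwap-B (Hole-¬Single hole-B) (pick-At A hB) ∷
         NotSwap-B (Full-¬Single full-B) (unpick-At A pB) ∷ inj₁ refl ∷ [])
        covers stable-indep
      where
      single-B-hA : Single B hA
      single-B-hA = single-B hA hA≢hB hA≢pB
      single-A-hB : Single A hB
      single-A-hB = single-A hB (≢-sym hA≢hB)
      single-A-pB : Single A pB
      single-A-pB = single-A pB (≢-sym hA≢pB)
      K : List (Fin n × Fin n)
      K = (pick B hA , pick A hB) ∷ (unpick A pB , t) ∷ []
      covers : Covers nothing K nothing
      covers e∈Δ (inj₁ refl) = there (there (there (here refl)))
      covers e∈Δ (inj₂ (i , e-at , ¬swap)) with i ≟ hA | i ≟ hB | i ≟ pB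
      ... | yes refl | _ | _ = here (Δ-hole-single hole-A single-B-hA e-at e∈Δ)
      ... | no _ | yes refl | _ = there (here (Δ-single-hole single-A-hB hole-B e-at e∈Δ))
      ... | no _ | no _ | yes refl = there (there (here (Δ-single-full single-A-pB full-B e-at e∈Δ)))
      ... | no i≢hA | no i≢hB | no i≢pB = ⊥-elim (unswapped-∉Δ (single-A i i≢hA) (single-B i i≢hB i≢pB) ¬swap e-at e∈Δ)
      stable-indep : StableIndep nothing K nothing
      stable-indep X X⊆A∪B stable full-AB _ =
        indep-if-some-hole (hole-if-only-edge X⊆A∪B (only-hole-single hole-A single-B-hA) (only-single-hole single-A-hB hole-B) (stable here))
          (λ t∈X i full → stable (there (there here)) (Full-at-∈ full (full-at-pB full-AB full) (unpick-At A pB)) t∈X)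
          (full-unique-at (full-at-pB full-AB))

    tipped-doubled : ∃[ p ] GoodPath M A B p
    tipped-doubled with hA ≟ hB | hA ≟ pB
    ... | yes hA≡hB | _ = tipped-doubled-≡ hA≡hB
    ... | no hA≢hB | yes hA≡pB = tipped-doubled-hole≡full hA≢hB hA≡pB
    ... | no hA≢hB | no hA≢pB = tipped-doubled-distinct hA≢hB hA≢pB

  module _ {hA} (t∈A : t ∈ A) (hole-A : Hole A hA) (single-A : ∀ i → i ≢ hA → Single A i)
                (t∉B : t ∉ B) (single-B : ∀ i → Single B i) where

    tipped-transversal : ∃[ p ] GoodPath M A B p
    tipped-transversal =
      swapLadder-goodPath (just (x∈p∧x∉q⇒x∈p─q t∈A t∉B)) [] (just (pick-B-side hole-A (single-B hA)))
        ((t≢At (pick-At B hA) ∷ []) ∷ [] ∷ [])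
        (inj₁ refl ∷ NotSwap-A (Hole-¬Single hole-A) (pick-At B hA) ∷ [])
        covers stable-indep
      where
      b : Fin n
      b = pick B hA
      covers : Covers (just t) [] (just b)
      covers e∈Δ (inj₁ refl) = here refl
      covers e∈Δ (inj₂ (i , e-at , ¬swap)) with i ≟ hA
      ... | yes refl = there (here (Δ-hole-single hole-A (single-B hA) e-at e∈Δ))
      ... | no i≢hA = ⊥-elim (unswapped-∉Δ (single-A i i≢hA) (single-B i) ¬swap e-at e∈Δ)
      ¬full : ∀ {X i} → FullInAB X → ¬ Full X i
      ¬full full-AB full = [ ¬Full-tipped hole-A single-A , (λ full-B → Full-¬Single full-B (single-B _)) ]′ (full-AB full)
      stable-indep : StableIndep (just t) [] (just b)
      stable-indep X X⊆A∪B stable full-AB missed =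
        indep-if-some-hole (hole-from-end X⊆A∪B (only-hole-single hole-A (single-B hA)) missed)
          (λ _ _ → ¬full full-AB) (λ _ _ full → ⊥-elim (¬full full-AB full))

  module _ {pA hA} (pA≢hA : pA ≢ hA) (t∉A : t ∉ A) (full-A : Full A pA) (hole-A : Hole A hA)
                   (single-A : ∀ i → i ≢ hA → i ≢ pA → Single A i)
                   (t∉B : t ∉ B) (single-B : ∀ i → Single B i) where

    doubled-transversal : ∃[ p ] GoodPath M A B p
    doubled-transversal =
      swapLadder-goodPath (just (unpick-B-side full-A (single-B pA))) [] (just (pick-B-side hole-A (single-B hA)))
        ((At-≢ (unpick-At B pA) (pick-At B hA) pA≢hA ∷ []) ∷ [] ∷ [])
        (NotSwap-A (Full-¬Single full-A) (unpick-At B pA) ∷ NotSwap-A (Hole-¬Single hole-A) (pick-At B hA) ∷ [])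
        covers stable-indep
      where
      a b : Fin n
      a = unpick B pA
      b = pick B hA
      covers : Covers (just a) [] (just b)
      covers e∈Δ (inj₁ refl) = ⊥-elim (tip∉ t∉A t∉B p─q∪q─p⊆p∪q e∈Δ)
      covers e∈Δ (inj₂ (i , e-at , ¬swap)) with i ≟ hA | i ≟ pA
      ... | yes refl | _ = there (here (Δ-hole-single hole-A (single-B hA) e-at e∈Δ))
      ... | no _ | yes refl = here (Δ-full-single full-A (single-B pA) e-at e∈Δ)
      ... | no i≢hA | no i≢pA = ⊥-elim (unswapped-∉Δ (single-A i i≢hA i≢pA) (single-B i) ¬swap e-at e∈Δ)
      full-at-pA : ∀ {X i} → FullInAB X → Full X i → i ≡ pA
      full-at-pA full-AB full = [ Full-doubled hole-A single-A , (λ full-B → ⊥-elim (Full-¬Single full-B (single-B _))) ]′ (full-AB full)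
      stable-indep : StableIndep (just a) [] (just b)
      stable-indep X X⊆A∪B stable full-AB missed =
        indep-if-some-hole (hole-from-end X⊆A∪B (only-hole-single hole-A (single-B hA)) missed)
          (λ t∈X → ⊥-elim (tip∉ t∉A t∉B X⊆A∪B t∈X)) (full-unique-at (full-at-pA full-AB))

  module _ (t∉A : t ∉ A) (single-A : ∀ i → Single A i) (t∉B : t ∉ B) (single-B : ∀ i → Single B i) where

    private
      Δ-swap : ∀ {e} → e ∈ Δ → ∃[ i ] (Swap i × At e i)
      Δ-swap {e} e∈Δ with ground e
      ... | inj₁ refl = ⊥-elim (tip∉ t∉A t∉B p─q∪q─p⊆p∪q e∈Δ)
      ... | inj₂ (i , e-at) with Swap? i
      ...   | yes swap = i , swap , e-at
      ...   | no ¬swap = ⊥-elim (unswapped-∉Δ (single-A i) (single-B i) ¬swap e-at e∈Δ)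

    transversal-transversal-≡ : swapRungs ≡ [] → ∃[ p ] GoodPath M A B p
    transversal-transversal-≡ no-swaps =
      swapLadder-goodPath nothing [] nothing [] [] (λ e∈Δ _ → ⊥-elim (Δ-empty e∈Δ))
        λ X X⊆A∪B _ _ _ → indep-⊆ (⊆∪∧disjoint⇒⊆ X⊆A∪B λ _ e∈B─A → Δ-empty (x∈p∪q⁺ (inj₂ e∈B─A))) indA
      where
      Δ-empty : ∀ {e} → e ∉ Δ
      Δ-empty e∈Δ with Δ-swap e∈Δ
      ... | _ , swap , e-at with subst (λ R → _ List.∈ rungs R) no-swaps (swap-∈-rungs swap e-at)
      ...   | ()

    -- The first swap rung provides the two ends; a stable set avoiding both has a hole there.
    transversal-transversal-≢ : ∀ {b a R} → swapRungs ≡ (b , a) ∷ R → ∃[ p ] GoodPath M A B p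
    transversal-transversal-≢ {b} {a} {R} swaps
      with subst (All SwapRung) swaps swapRungs-SwapRung | subst (Unique ∘ rungs) swaps Unique-swapRungs
    ... | (i₀ , swap₀ , refl) ∷ swap-rungs | b∉ ∷ a∉ ∷ unique =
      ladder (just a) R (just b) ,
      ladder-goodPath indA indB (just (proj₁ swap₀)) (All.map SwapRung-Rung swap-rungs) (just (proj₂ swap₀))
        (All.++⁺ a∉ (pick≢unpick A i₀ ∷ []) ∷
         Unique.++⁺ unique ([] ∷ []) (λ { (e∈ , here refl) → All.lookup (All.tail b∉) e∈ refl }))
        covers stable-indep
      where
      covers : ∀ e → e ∈ Δ → e List.∈ ladder (just a) R (just b)
      covers e e∈Δ with Δ-swap e∈Δ
      ... | i , swap , e-at with subst (λ R → e List.∈ rungs R) swaps (swap-∈-rungs swap e-at)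
      ...   | here refl = ∈-++⁺ʳ (a ∷ rungs R) (here refl)
      ...   | there (here refl) = here refl
      ...   | there (there e∈R) = there (∈-++⁺ˡ e∈R)
      hole : ∀ {X} → Any (Misses X) R ⊎ (Maybe.All (_∉ X) (just a) × Maybe.All (_∉ X) (just b)) → ∃[ h ] Hole X h
      hole (inj₁ missed) = missed-swap-hole swap-rungs missed
      hole (inj₂ (just a∉X , just b∉X)) = i₀ , Hole-intro (pick-At A i₀) (unpick-At A i₀) (pick≢unpick A i₀) a∉X b∉X
      full-at-i₀ : ∀ {X i} → X ⊆ A ∪ B → Stable (ladder (just a) R (just b)) X → Full X i → i ≡ i₀
      full-at-i₀ {X} {i} X⊆A∪B stable full with Swap? i | i ≟ i₀
      ... | _ | yes i≡i₀ = i≡i₀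
      ... | no ¬swap | no _ =
        ⊥-elim ([ (λ full-A → Full-¬Single full-A (single-A i)) , (λ full-B → Full-¬Single full-B (single-B i)) ]′
                  (Full-unswapped X⊆A∪B full ¬swap))
      ... | yes swap | no i≢i₀ with subst (swapRung i List.∈_) swaps (swapRung∈ swap)
      ...   | here rung≡ = ⊥-elim (i≢i₀ (At-unique (pick-At A i) (subst (λ f → At f i₀) (sym (cong proj₂ rung≡)) (pick-At A i₀))))
      ...   | there rung∈R = ⊥-elim (stable (there (rung-consecutive {ma = nothing} {bas = R} {mb = just b} rung∈R))
                                           (Full-At full (unpick-At A i)) (Full-At full (pick-At A i)))
      stable-indep : ∀ X → X ⊆ A ∪ B → Stable (ladder (just a) R (just b)) X →
        Any (Misses X) R ⊎ (Maybe.All (_∉ X) (just a) × Maybe.All (_∉ X) (just b)) → Indep X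
      stable-indep X X⊆A∪B stable missed =
        indep-if-some-hole (hole missed) (λ t∈X → ⊥-elim (tip∉ t∉A t∉B X⊆A∪B t∈X)) (full-unique-at (full-at-i₀ X⊆A∪B stable))

    transversal-transversal : ∃[ p ] GoodPath M A B p
    transversal-transversal with swapRungs in swaps
    ... | [] = transversal-transversal-≡ swaps
    ... | _ ∷ _ = transversal-transversal-≢ swaps

  module BothDoubled {pA hA pB hB} (pA≢hA : pA ≢ hA) (t∉A : t ∉ A) (full-A : Full A pA) (hole-A : Hole A hA)
                     (single-A : ∀ i → i ≢ hA → i ≢ pA → Single A i)
                     (pB≢hB : pB ≢ hB) (t∉B : t ∉ B) (full-B : Full B pB) (hole-B : Hole B hB)
                     (single-B : ∀ i → i ≢ hB → i ≢ pB → Single B i) where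

    private
      t∉Δ : t ∉ Δ
      t∉Δ = tip∉ t∉A t∉B p─q∪q─p⊆p∪q

      no-tip : ∀ {X} → X ⊆ A ∪ B → t ∈ X → ∀ i → ¬ Full X i
      no-tip X⊆A∪B t∈X = ⊥-elim (tip∉ t∉A t∉B X⊆A∪B t∈X)

      full-at : ∀ {X i} → FullInAB X → Full X i → i ≡ pA ⊎ i ≡ pB
      full-at full-AB full = Data.Sum.map (Full-doubled hole-A single-A) (Full-doubled hole-B single-B) (full-AB full)

      full-unique : ∀ {X} → (∀ {i} → Full X i → i ≡ pA ⊎ i ≡ pB) → (Full X pA → ¬ Full X pB) →
        ∀ i j → Full X i → Full X j → i ≡ j
      full-unique at ¬both i j full-i full-j with at full-i | at full-j
      ... | inj₁ refl | inj₁ refl = refl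
      ... | inj₂ refl | inj₂ refl = refl
      ... | inj₁ refl | inj₂ refl = ⊥-elim (¬both full-i full-j)
      ... | inj₂ refl | inj₁ refl = ⊥-elim (¬both full-j full-i)

      full-at-same : ∀ {X i} → pA ≡ pB → FullInAB X → Full X i → i ≡ pA
      full-at-same refl full-AB full = [ (λ i≡p → i≡p) , (λ i≡p → i≡p) ]′ (full-at full-AB full)

    same : pA ≡ pB → hA ≡ hB → ∃[ p ] GoodPath M A B p
    same pA≡pB refl = swapLadder-goodPath nothing [] nothing [] [] covers stable-indep
      where
      covers : Covers nothing [] nothing
      covers e∈Δ (inj₁ refl) = ⊥-elim (t∉Δ e∈Δ)
      covers e∈Δ (inj₂ (i , e-at , ¬swap)) with i ≟ hA | i ≟ pA
      ... | yes refl | _ = ⊥-elim (Δ-hole-hole hole-A hole-B e-at e∈Δ)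
      ... | no _ | yes refl = ⊥-elim (Δ-full-full full-A (subst (Full B) (sym pA≡pB) full-B) e-at e∈Δ)
      ... | no i≢h | no i≢p =
        ⊥-elim (unswapped-∉Δ (single-A i i≢h i≢p) (single-B i i≢h (i≢p ∘ (λ i≡pB → trans i≡pB (sym pA≡pB)))) ¬swap e-at e∈Δ)
      stable-indep : StableIndep nothing [] nothing
      stable-indep X X⊆A∪B stable full-AB _ =
        indep-if-hole 2≤r (hole-if-hole-hole X⊆A∪B hole-A hole-B) (no-tip X⊆A∪B)
          (full-unique-at (full-at-same pA≡pB full-AB))

    same-full : pA ≡ pB → hA ≢ hB → ∃[ p ] GoodPath M A B p
    same-full refl hA≢hB =
      swapLadder-goodPath nothing ((pick-B-side hole-A single-B-hA , pick-A-side single-A-hB hole-B) ∷ []) nothing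
        ((At-≢ (pick-At B hA) (pick-At A hB) hA≢hB ∷ []) ∷ [] ∷ [])
        (NotSwap-A (Hole-¬Single hole-A) (pick-At B hA) ∷ NotSwap-B (Hole-¬Single hole-B) (pick-At A hB) ∷ [])
        covers stable-indep
      where
      single-B-hA : Single B hA
      single-B-hA = single-B hA hA≢hB (≢-sym pA≢hA)
      single-A-hB : Single A hB
      single-A-hB = single-A hB (≢-sym hA≢hB) (≢-sym pB≢hB)
      K : List (Fin n × Fin n)
      K = (pick B hA , pick A hB) ∷ []
      covers : Covers nothing K nothing
      covers e∈Δ (inj₁ refl) = ⊥-elim (t∉Δ e∈Δ)
      covers e∈Δ (inj₂ (i , e-at , ¬swap)) with i ≟ hA | i ≟ hB | i ≟ pA
      ... | yes refl | _ | _ = here (Δ-hole-single hole-A single-B-hA e-at e∈Δ)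
      ... | no _ | yes refl | _ = there (here (Δ-single-hole single-A-hB hole-B e-at e∈Δ))
      ... | no _ | no _ | yes refl = ⊥-elim (Δ-full-full full-A full-B e-at e∈Δ)
      ... | no i≢hA | no i≢hB | no i≢p = ⊥-elim (unswapped-∉Δ (single-A i i≢hA i≢p) (single-B i i≢hB i≢p) ¬swap e-at e∈Δ)
      stable-indep : StableIndep nothing K nothing
      stable-indep X X⊆A∪B stable full-AB _ =
        indep-if-some-hole (hole-if-only-edge X⊆A∪B (only-hole-single hole-A single-B-hA) (only-single-hole single-A-hB hole-B) (stable here))
          (no-tip X⊆A∪B) (full-unique-at (full-at-same refl full-AB))

    same-hole : pA ≢ pB → hA ≡ hB → ∃[ p ] GoodPath M A B p
    same-hole pA≢pB refl =
      swapLadder-goodPath nothing ((unpick-A-side single-A-pB full-B , unpick-B-side full-A single-B-pA) ∷ []) nothing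
        ((At-≢ (unpick-At A pB) (unpick-At B pA) (≢-sym pA≢pB) ∷ []) ∷ [] ∷ [])
        (NotSwap-B (Full-¬Single full-B) (unpick-At A pB) ∷ NotSwap-A (Full-¬Single full-A) (unpick-At B pA) ∷ [])
        covers stable-indep
      where
      single-A-pB : Single A pB
      single-A-pB = single-A pB pB≢hB (≢-sym pA≢pB)
      single-B-pA : Single B pA
      single-B-pA = single-B pA pA≢hA pA≢pB
      K : List (Fin n × Fin n)
      K = (unpick A pB , unpick B pA) ∷ []
      covers : Covers nothing K nothing
      covers e∈Δ (inj₁ refl) = ⊥-elim (t∉Δ e∈Δ)
      covers e∈Δ (inj₂ (i , e-at , ¬swap)) with i ≟ hA | i ≟ pB | i ≟ pA
      ... | yes refl | _ | _ = ⊥-elim (Δ-hole-hole hole-A hole-B e-at e∈Δ)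
      ... | no _ | yes refl | _ = here (Δ-single-full single-A-pB full-B e-at e∈Δ)
      ... | no _ | no _ | yes refl = there (here (Δ-full-single full-A single-B-pA e-at e∈Δ))
      ... | no i≢h | no i≢pB | no i≢pA = ⊥-elim (unswapped-∉Δ (single-A i i≢h i≢pA) (single-B i i≢h i≢pB) ¬swap e-at e∈Δ)
      stable-indep : StableIndep nothing K nothing
      stable-indep X X⊆A∪B stable full-AB _ =
        indep-if-hole 2≤r (hole-if-hole-hole X⊆A∪B hole-A hole-B) (no-tip X⊆A∪B)
          (full-unique (full-at full-AB)
                       (λ full-pA full-pB → stable here (Full-At full-pB (unpick-At A pB)) (Full-At full-pA (unpick-At B pA))))

    hole≡full : pA ≢ pB → hA ≢ hB → hA ≡ pB → hB ≢ pA → ∃[ p ] GoodPath M A B p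
    hole≡full pA≢pB hA≢hB refl hB≢pA =
      swapLadder-goodPath nothing
        ((x∈p∧x∉q⇒x∈p─q (proj₁ full-B) (proj₁ hole-A) , pick-A-side single-A-hB hole-B) ∷
         (x∈p∧x∉q⇒x∈p─q (proj₂ full-B) (proj₂ hole-A) , unpick-B-side full-A single-B-pA) ∷ []) nothing
        ((At-≢ (inj₁ refl) (pick-At A hB) hA≢hB ∷ x≢y q q ∷ At-≢ (inj₁ refl) (unpick-At B pA) (≢-sym pA≢pB) ∷ []) ∷
         (At-≢ (pick-At A hB) (inj₂ refl) (≢-sym hA≢hB) ∷ At-≢ (pick-At A hB) (unpick-At B pA) hB≢pA ∷ []) ∷
         (At-≢ (inj₂ refl) (unpick-At B pA) (≢-sym pA≢pB) ∷ []) ∷ [] ∷ [])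
        (NotSwap-A (Hole-¬Single hole-A) (inj₁ refl) ∷ NotSwap-B (Hole-¬Single hole-B) (pick-At A hB) ∷
         NotSwap-A (Hole-¬Single hole-A) (inj₂ refl) ∷ NotSwap-A (Full-¬Single full-A) (unpick-At B pA) ∷ [])
        covers stable-indep
      where
      q : Fin r
      q = hA
      single-A-hB : Single A hB
      single-A-hB = single-A hB (≢-sym hA≢hB) hB≢pA
      single-B-pA : Single B pA
      single-B-pA = single-B pA (≢-sym hB≢pA) pA≢pB
      a : Fin n
      a = pick A hB
      K : List (Fin n × Fin n)
      K = (x q , a) ∷ (y q , unpick B pA) ∷ []
      covers : Covers nothing K nothing
      covers e∈Δ (inj₁ refl) = ⊥-elim (t∉Δ e∈Δ)
      covers e∈Δ (inj₂ (i , e-at , ¬swap)) with i ≟ q | i ≟ hB | i ≟ pA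
      ... | yes refl | _ | _ = [ here , (λ e≡y → there (there (here e≡y))) ]′ e-at
      ... | no _ | yes refl | _ = there (here (Δ-single-hole single-A-hB hole-B e-at e∈Δ))
      ... | no _ | no _ | yes refl = there (there (there (here (Δ-full-single full-A single-B-pA e-at e∈Δ))))
      ... | no i≢q | no i≢hB | no i≢pA = ⊥-elim (unswapped-∉Δ (single-A i i≢q i≢pA) (single-B i i≢hB i≢q) ¬swap e-at e∈Δ)
      hole : ∀ {X} → X ⊆ A ∪ B → Stable (ladder nothing (K ++ swapRungs) nothing) X → ∃[ h ] Hole X h
      hole {X} X⊆A∪B stable with a ∈? X
      ... | yes a∈X = q , (λ x∈X → stable here x∈X a∈X) , stable (there here) a∈X
      ... | no a∉X = hB , hole-if-only X⊆A∪B (only-single-hole single-A-hB hole-B) a∉X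
      stable-indep : StableIndep nothing K nothing
      stable-indep X X⊆A∪B stable full-AB _ =
        indep-if-some-hole (hole X⊆A∪B stable) (no-tip X⊆A∪B)
          (full-unique (full-at full-AB)
                       (λ full-pA full-q → stable (there (there here)) (proj₂ full-q) (Full-At full-pA (unpick-At B pA))))

    distinct : pA ≢ pB → hA ≢ hB → hA ≢ pB → hB ≢ pA → ∃[ p ] GoodPath M A B p
    distinct pA≢pB hA≢hB hA≢pB hB≢pA =
      swapLadder-goodPath nothing
        ((pick-B-side hole-A single-B-hA , pick-A-side single-A-hB hole-B) ∷
         (unpick-A-side single-A-pB full-B , unpick-B-side full-A single-B-pA) ∷ []) nothing
        ((At-≢ (pick-At B hA) (pick-At A hB) hA≢hB ∷ At-≢ (pick-At B hA) (unpick-At A pB) hA≢pB ∷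
          At-≢ (pick-At B hA) (unpick-At B pA) (≢-sym pA≢hA) ∷ []) ∷
         (At-≢ (pick-At A hB) (unpick-At A pB) (≢-sym pB≢hB) ∷ At-≢ (pick-At A hB) (unpick-At B pA) hB≢pA ∷ []) ∷
         (At-≢ (unpick-At A pB) (unpick-At B pA) (≢-sym pA≢pB) ∷ []) ∷ [] ∷ [])
        (NotSwap-A (Hole-¬Single hole-A) (pick-At B hA) ∷ NotSwap-B (Hole-¬Single hole-B) (pick-At A hB) ∷
         NotSwap-B (Full-¬Single full-B) (unpick-At A pB) ∷ NotSwap-A (Full-¬Single full-A) (unpick-At B pA) ∷ [])
        covers stable-indep
      where
      single-B-hA : Single B hA
      single-B-hA = single-B hA hA≢hB hA≢pB
      single-A-hB : Single A hB
      single-A-hB = single-A hB (≢-sym hA≢hB) hB≢pA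
      single-A-pB : Single A pB
      single-A-pB = single-A pB (≢-sym hA≢pB) (≢-sym pA≢pB)
      single-B-pA : Single B pA
      single-B-pA = single-B pA (≢-sym hB≢pA) pA≢pB
      K : List (Fin n × Fin n)
      K = (pick B hA , pick A hB) ∷ (unpick A pB , unpick B pA) ∷ []
      covers : Covers nothing K nothing
      covers e∈Δ (inj₁ refl) = ⊥-elim (t∉Δ e∈Δ)
      covers e∈Δ (inj₂ (i , e-at , ¬swap)) with i ≟ hA | i ≟ hB | i ≟ pB | i ≟ pA
      ... | yes refl | _ | _ | _ = here (Δ-hole-single hole-A single-B-hA e-at e∈Δ)
      ... | no _ | yes refl | _ | _ = there (here (Δ-single-hole single-A-hB hole-B e-at e∈Δ))
      ... | no _ | no _ | yes refl | _ = there (there (here (Δ-single-full single-A-pB full-B e-at e∈Δ)))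
      ... | no _ | no _ | no _ | yes refl = there (there (there (here (Δ-full-single full-A single-B-pA e-at e∈Δ))))
      ... | no i≢hA | no i≢hB | no i≢pB | no i≢pA =
        ⊥-elim (unswapped-∉Δ (single-A i i≢hA i≢pA) (single-B i i≢hB i≢pB) ¬swap e-at e∈Δ)
      stable-indep : StableIndep nothing K nothing
      stable-indep X X⊆A∪B stable full-AB _ =
        indep-if-some-hole (hole-if-only-edge X⊆A∪B (only-hole-single hole-A single-B-hA) (only-single-hole single-A-hB hole-B) (stable here))
          (no-tip X⊆A∪B)
          (full-unique (full-at full-AB)
                       (λ full-pA full-pB → stable (there (there here)) (Full-At full-pB (unpick-At A pB)) (Full-At full-pA (unpick-At B pA))))

    -- A stable set containing u and y q but neither x q nor u′ avoids the A-side of every swap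
    -- rung it meets, so it lies in B - x q + u: this is why u is chosen to make that set independent.
    module Crossed (pA≢pB : pA ≢ pB) (hA≡pB : hA ≡ pB) (hB≡pA : hB ≡ pA) {u u′ : Fin n}
                   (u-at : At u pA) (u′-at : At u′ pA) (u≢u′ : u ≢ u′) (ind : Indep ((B ─ ⁅ x pB ⁆) ∪ ⁅ u ⁆)) where

      private
        p q : Fin r
        p = pA
        q = pB
        hole-A-q : Hole A q
        hole-A-q = subst (Hole A) hA≡pB hole-A
        hole-B-p : Hole B p
        hole-B-p = subst (Hole B) hB≡pA hole-B
        single-A′ : ∀ i → i ≢ q → i ≢ p → Single A i
        single-A′ i i≢q = single-A i (λ i≡hA → i≢q (trans i≡hA hA≡pB))
        single-B′ : ∀ i → i ≢ p → i ≢ q → Single B i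
        single-B′ i i≢p = single-B i (λ i≡hB → i≢p (trans i≡hB hB≡pA))

      K : List (Fin n × Fin n)
      K = (x q , u′) ∷ []

      Path : List (Fin n)
      Path = ladder (just u) (K ++ swapRungs) (just (y q))

      Hypothesis : Subset n → Set
      Hypothesis X = Any (Misses X) K ⊎ (∃[ h ] Hole X h) ⊎ (Maybe.All (_∉ X) (just u) × Maybe.All (_∉ X) (just (y q)))

      covers : ∀ {e} → e ∈ Δ → NotSwap e → e List.∈ u ∷ x q ∷ u′ ∷ y q ∷ []
      covers e∈Δ (inj₁ refl) = ⊥-elim (t∉Δ e∈Δ)
      covers e∈Δ (inj₂ (i , e-at , ¬swap)) with i ≟ p | i ≟ q
      ... | yes refl | _ = [ here , (λ e≡u′ → there (there (here e≡u′))) ]′ (At-other u-at u′-at u≢u′ e-at)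
      ... | no _ | yes refl = [ (λ e≡x → there (here e≡x)) , (λ e≡y → there (there (there (here e≡y)))) ]′ e-at
      ... | no i≢p | no i≢q = ⊥-elim (unswapped-∉Δ (single-A′ i i≢q i≢p) (single-B′ i i≢p i≢q) ¬swap e-at e∈Δ)

      hole-p : ∀ {X} → u ∉ X → u′ ∉ X → Hole X p
      hole-p = Hole-intro u-at u′-at u≢u′

      confined : ∀ {X} → X ⊆ A ∪ B → x q ∉ X → u′ ∉ X →
        All (λ ba → proj₁ ba ∈ X × proj₂ ba ∉ X) swapRungs → X ⊆ (B ─ ⁅ x q ⁆) ∪ ⁅ u ⁆
      confined {X} X⊆A∪B xq∉X u′∉X swaps-B {e} e∈X with e ∈? B
      ... | yes e∈B = p⊆p∪q _ (x∈p∧x∉q⇒x∈p─q e∈B (λ e∈xq → xq∉X (subst (_∈ X) (x∈⁅y⁆⇒x≡y _ e∈xq) e∈X)))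
      ... | no e∉B with x∈p∪q∧x∉p⇒x∈q (x∈p∪q⇒x∈q∪p (X⊆A∪B e∈X)) e∉B | ground e
      ...   | e∈A | inj₁ refl = ⊥-elim (t∉A e∈A)
      ...   | e∈A | inj₂ (i , e-at) with Swap? i | i ≟ p | i ≟ q
      ...     | yes swap | _ | _ =
        ⊥-elim (proj₂ (All.lookup swaps-B (swapRung∈ swap)) (subst (_∈ X) (Single-∈ (proj₁ (Swap⇒Single swap)) e-at e∈A) e∈X))
      ...     | no _ | yes refl | _ =
        [ (λ e≡u → subst (_∈ _) (sym e≡u) y∈p∪⁅y⁆) , (λ e≡u′ → ⊥-elim (u′∉X (subst (_∈ X) e≡u′ e∈X))) ]′
          (At-other u-at u′-at u≢u′ e-at)
      ...     | no _ | no _ | yes refl = ⊥-elim (Hole-At hole-A-q e-at e∈A)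
      ...     | no ¬swap | no i≢p | no i≢q =
        ⊥-elim (unswapped-∉Δ (single-A′ i i≢q i≢p) (single-B′ i i≢p i≢q) ¬swap e-at
                             (x∈p∪q⁺ (inj₁ (x∈p∧x∉q⇒x∈p─q e∈A e∉B))))

      hole-or-confined : ∀ {X} → X ⊆ A ∪ B → Stable Path X → Hypothesis X →
        ∃[ h ] Hole X h ⊎ X ⊆ (B ─ ⁅ x q ⁆) ∪ ⁅ u ⁆
      hole-or-confined {X} X⊆A∪B stable hyp with x q ∈? X | y q ∈? X | u ∈? X | u′ ∈? X | hyp
      ... | yes xq∈X | _ | _ | _ | _ = inj₁ (p , hole-p (λ u∈X → stable here u∈X xq∈X) (stable (there here) xq∈X))
      ... | no xq∉X | no yq∉X | _ | _ | _ = inj₁ (q , xq∉X , yq∉X)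
      ... | no _ | yes _ | no u∉X | no u′∉X | _ = inj₁ (p , hole-p u∉X u′∉X)
      ... | no _ | yes _ | _ | _ | inj₂ (inj₁ hole) = inj₁ hole
      ... | no _ | yes yq∈X | _ | _ | inj₂ (inj₂ (_ , just yq∉X)) = ⊥-elim (yq∉X yq∈X)
      ... | no _ | yes _ | _ | yes u′∈X | inj₁ (here (_ , u′∉X)) = ⊥-elim (u′∉X u′∈X)
      ... | no xq∉X | yes yq∈X | yes _ | no u′∉X | inj₁ _ with all-meet⊎any-missed X swapRungs
      ...   | inj₂ missed = inj₁ (missed-swap-hole swapRungs-SwapRung missed)
      ...   | inj₁ meets = inj₂ (confined X⊆A∪B xq∉X u′∉X
                                  (proj₂ (stable-backward nothing swapRungs (Stable-++ (u ∷ x q ∷ u′ ∷ []) stable) meets yq∈X)))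

      stable-indep : StableIndep (just u) K (just (y q))
      stable-indep X X⊆A∪B stable full-AB hyp with hole-or-confined X⊆A∪B stable hyp
      ... | inj₁ hole = indep-if-some-hole hole (no-tip X⊆A∪B)
                          (full-unique (full-at full-AB)
                                       (λ full-p full-q → stable here (Full-At full-p u-at) (proj₁ full-q)))
      ... | inj₂ X⊆W = indep-⊆ X⊆W ind

      goodPath : ∃[ p ] GoodPath M A B p
      goodPath =
        swapLadder-goodPath {just u} {K} {just (y q)}
          (just (x∈p∧x∉q⇒x∈p─q (Full-At full-A u-at) (Hole-At hole-B-p u-at)))
          ((x∈p∧x∉q⇒x∈p─q (proj₁ full-B) (proj₁ hole-A-q) ,
            x∈p∧x∉q⇒x∈p─q (Full-At full-A u′-at) (Hole-At hole-B-p u′-at)) ∷ [])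
          (just (x∈p∧x∉q⇒x∈p─q (proj₂ full-B) (proj₂ hole-A-q)))
          ((At-≢ u-at (inj₁ refl) pA≢pB ∷ u≢u′ ∷ At-≢ u-at (inj₂ refl) pA≢pB ∷ []) ∷
           (At-≢ (inj₁ refl) u′-at (≢-sym pA≢pB) ∷ x≢y q q ∷ []) ∷
           (At-≢ u′-at (inj₂ refl) pA≢pB ∷ []) ∷ [] ∷ [])
          (NotSwap-A (Full-¬Single full-A) u-at ∷ NotSwap-A (Hole-¬Single hole-A-q) (inj₁ refl) ∷
           NotSwap-A (Full-¬Single full-A) u′-at ∷ NotSwap-A (Hole-¬Single hole-A-q) (inj₂ refl) ∷ [])
          covers stable-indep

    crossed : pA ≢ pB → hA ≡ pB → hB ≡ pA → ∃[ p ] GoodPath M A B p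
    crossed pA≢pB hA≡pB hB≡pA with indep? ((B ─ ⁅ x pB ⁆) ∪ ⁅ x pA ⁆)
    ... | yes ind = Crossed.goodPath pA≢pB hA≡pB hB≡pA (inj₁ refl) (inj₂ refl) (x≢y pA pA) ind
    ... | no ¬ind = Crossed.goodPath pA≢pB hA≡pB hB≡pA (inj₂ refl) (inj₁ refl) (≢-sym (x≢y pA pA))
                      (exchange t∉W (indep-if-hole 2≤r (Hole-∪-tip hole-W) (λ _ _ → ¬full) (λ _ _ full → ⊥-elim (¬full full)))
                                (proj₁ hole-W) (proj₂ hole-W) ¬ind)
      where
      W : Subset n
      W = B ─ ⁅ x pB ⁆
      t∉W : t ∉ W
      t∉W t∈W = t∉B (p─q⊆p B _ t∈W)
      hole-W : Hole W pA
      hole-W = (λ x∈W → proj₁ hole-B-pA (p─q⊆p B _ x∈W)) , (λ y∈W → proj₂ hole-B-pA (p─q⊆p B _ y∈W))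
        where
        hole-B-pA : Hole B pA
        hole-B-pA = subst (Hole B) hB≡pA hole-B
      ¬full : ∀ {i} → ¬ Full (W ∪ ⁅ t ⁆) i
      ¬full full with Full-∪-tip full
      ... | xi∈W , yi∈W with Full-doubled hole-B single-B (p─q⊆p B _ xi∈W , p─q⊆p B _ yi∈W)
      ...   | refl = x∈p─q⇒x∉q xi∈W (x∈⁅x⁆ (x pB))

module _ {n r : ℕ} {t : Fin n} {x y : Fin r → Fin n} {M : Matroid n} (S : IsSpike r t x y M) (2≤r : 2 ≤ r) where
  open Matroid M
  open Spike S

  private
    swap-goodPath : ∀ {A B : Subset n} → ∃[ p ] GoodPath M B A p → ∃[ p ] GoodPath M A B p
    swap-goodPath = Data.Product.map₂ (goodPath-sym M)

  goodPath-of-shapes : ∀ {A B : Subset n} → Indep A → Indep B → Shape A → Shape B → ∃[ p ] GoodPath M A B p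
  goodPath-of-shapes {A} {B} indA indB = go
    where
    module AB = BasisPair S 2≤r A B indA indB
    module BA = BasisPair S 2≤r B A indB indA
    go : Shape A → Shape B → ∃[ p ] GoodPath M A B p
    go (tipped _ t∈A hole-A single-A) (tipped _ t∈B hole-B single-B) = AB.tipped-tipped t∈A hole-A single-A t∈B hole-B single-B
    go (tipped _ t∈A hole-A single-A) (doubled _ _ p≢h t∉B full-B hole-B single-B) =
      AB.tipped-doubled t∈A hole-A single-A p≢h t∉B full-B hole-B single-B
    go (doubled _ _ p≢h t∉A full-A hole-A single-A) (tipped _ t∈B hole-B single-B) =
      swap-goodPath (BA.tipped-doubled t∈B hole-B single-B p≢h t∉A full-A hole-A single-A)
    go (tipped _ t∈A hole-A single-A) (transversal t∉B single-B) = AB.tipped-transversal t∈A hole-A single-A t∉B single-B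
    go (transversal t∉A single-A) (tipped _ t∈B hole-B single-B) = swap-goodPath (BA.tipped-transversal t∈B hole-B single-B t∉A single-A)
    go (doubled _ _ p≢h t∉A full-A hole-A single-A) (transversal t∉B single-B) =
      AB.doubled-transversal p≢h t∉A full-A hole-A single-A t∉B single-B
    go (transversal t∉A single-A) (doubled _ _ p≢h t∉B full-B hole-B single-B) =
      swap-goodPath (BA.doubled-transversal p≢h t∉B full-B hole-B single-B t∉A single-A)
    go (transversal t∉A single-A) (transversal t∉B single-B) = AB.transversal-transversal t∉A single-A t∉B single-B
    go (doubled pA hA pA≢hA t∉A full-A hole-A single-A) (doubled pB hB pB≢hB t∉B full-B hole-B single-B) =
      both-doubled (pA ≟ pB) (hA ≟ hB) (hA ≟ pB) (hB ≟ pA)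
      where
      module DA = AB.BothDoubled pA≢hA t∉A full-A hole-A single-A pB≢hB t∉B full-B hole-B single-B
      module DB = BA.BothDoubled pB≢hB t∉B full-B hole-B single-B pA≢hA t∉A full-A hole-A single-A
      both-doubled : Dec (pA ≡ pB) → Dec (hA ≡ hB) → Dec (hA ≡ pB) → Dec (hB ≡ pA) → ∃[ p ] GoodPath M A B p
      both-doubled (yes pA≡pB) (yes hA≡hB) _ _ = DA.same pA≡pB hA≡hB
      both-doubled (yes pA≡pB) (no hA≢hB) _ _ = DA.same-full pA≡pB hA≢hB
      both-doubled (no pA≢pB) (yes hA≡hB) _ _ = DA.same-hole pA≢pB hA≡hB
      both-doubled (no pA≢pB) (no _) (yes hA≡pB) (yes hB≡pA) = DA.crossed pA≢pB hA≡pB hB≡pA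
      both-doubled (no pA≢pB) (no hA≢hB) (yes hA≡pB) (no hB≢pA) = DA.hole≡full pA≢pB hA≢hB hA≡pB hB≢pA
      both-doubled (no pA≢pB) (no hA≢hB) (no hA≢pB) (yes hB≡pA) =
        swap-goodPath (DB.hole≡full (≢-sym pA≢pB) (≢-sym hA≢hB) hB≡pA hA≢pB)
      both-doubled (no pA≢pB) (no hA≢hB) (no hA≢pB) (no hB≢pA) = DA.distinct pA≢pB hA≢hB hA≢pB hB≢pA

  spike-goodPath : ∀ {A B : Subset n} → Basis M A → Basis M B → ∃[ p ] GoodPath M A B p
  spike-goodPath basis-A basis-B =
    goodPath-of-shapes (proj₁ basis-A) (proj₁ basis-B) (shape 2≤r basis-A) (shape 2≤r basis-B)

theorem17 : ∀ {n} (r : ℕ) (t : Fin n) (x y : Fin r → Fin n) (M : Matroid n) →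
    IsSpike r t x y M → PropertyP+ M
theorem17 zero t x y M S = rank-zero-propertyP+ M (IsSpike.rank-r S)
theorem17 (suc _) t x y M S _ _ basis-A basis-B = spike-goodPath S (Spike.two≤rank S (s≤s z≤n)) basis-A basis-B
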